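{- Let $\mathcal{L}$ be a finite meet-semilattice, and let $\mathcal{G}_1$ and $\mathcal{G}_2=\mathcal{G}_1\cup\{b\}$, with $b\notin\mathcal{G}_1$, be building sets of $\mathcal{L}$. Let $R$ be a commutative ring, $\chi:N(\mathcal{G}_1)\to\mathbb{Z}$ any function, and $\alpha:\mathcal{G}_2\to R^\times$ a function such that $\alpha(b)=\sum_{F\in F_{\mathcal{G}_1}(b)}\alpha(F)$. Then $$Z_{\mathcal{L}}^{\mathcal{G}_1,\chi,\alpha}=Z_{\mathcal{L}}^{\mathcal{G}_2,Bl_b\chi,\alpha},$$ where on the left $\alpha$ is restricted to $\mathcal{G}_1$.
   Context: All posets are finite. For $S\subset\mathcal{L}$, $x\in\mathcal{L}$, $S_{\le x}=\{y\in S:y\le x\}$; $\max S$ is the set of maximal elements; $\bigvee T$ is the join of $T$ when it exists. A meet-semilattice has a least element $\hat 0$; $[a,b]=\{x:a\le x\le b\}$; products of posets carry the componentwise order. A subset $\mathcal{G}\subset\mathcal{L}\setminus\{\hat0\}$ is a building set if for every $p\in\mathcal{L}\setminus\{\hat0\}$ there is a poset isomorphism $\phi:[\hat0,p]\to\prod_{g\in F_{\mathcal{G}}(p)}[\hat0,g]$ with $\phi(g)=(\hat0,\dots,g,\dots,\hat0)$ ($g$ in the $g$-th coordinate) for all $g\in F_{\mathcal{G}}(p)$, where $F_{\mathcal{G}}(p)=\max\{g\in\mathcal{G}: g\le p\}$. The nested set complex $N(\mathcal{G})$ is the set of all subsets $S\subset\mathcal{G}$ (including $\emptyset$) such that for every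 $T\subset S$ with $|T|\ge2$ of pairwise incomparable elements, $\bigvee T$ exists and $\bigvee T\notin\mathcal{G}$. For a building set $\mathcal{G}$, a function $\chi:N(\mathcal{G})\to\mathbb{Z}$ and a function $\alpha:\mathcal{G}\to R^\times$ ($R$ a commutative ring), define $$Z_{\mathcal{L}}^{\mathcal{G},\chi,\alpha}=\sum_{U\in N(\mathcal{G})}\chi^\circ(U)\prod_{A\in U}\alpha(A)^{ -1},\qquad \chi^\circ(U)=\sum_{T\in N(\mathcal{G}),\,T\supseteq U}(-1)^{|T|-|U|}\chi(T).$$ For building sets $\mathcal{G}_1$, $\mathcal{G}_2=\mathcal{G}_1\cup\{b\}$ ($b\notin\mathcal{G}_1$), write $F=F_{\mathcal{G}_1}(b)$; for $f:N(\mathcal{G}_1)\to\mathbb{Z}$ the function $Bl_bf:N(\mathcal{G}_2)\to\mathbb{Z}$ is defined by: $Bl_bf(S)=f(S)$ if $b\notin S$ and $S\cup F\notin N(\mathcal{G}_1)$; $Bl_bf(S)=f(S)+f(S\cup F)(|F\setminus S|-1)$ if $b\notin S$ and $S\cup F\in N(\mathcal{G}_1)$; $Bl_bf(S)=f(S\setminus\{b\}\cup F)\,|F\setminus S|$ if $b\in S$. -}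

module Defs where

open import Level using (Level; 0ℓ)
open import Data.Nat as ℕ using (ℕ; zero; suc)
open import Data.Integer as ℤ using (ℤ; +_; -[1+_])
open import Data.Fin using (Fin)
open import Data.Fin.Properties using (all?; any?) renaming (_≟_ to _≟ᶠ_)
open import Data.Fin.Subset as Sub using (Subset; inside; outside; _∈_; _∉_; _⊆_; _∪_; _─_; ⁅_⁆)
open import Data.Fin.Subset.Properties using (_∈?_; _⊆?_; anySubset?)
open import Data.Vec using ([]; _∷_; tabulate)
open import Data.List using (List; []; _∷_; _++_; map; filter; foldr; allFin)
open import Data.Product using (Σ; Σ-syntax; ∃; _×_; _,_)
open import Data.Bool using (true; false; if_then_else_)
open import Relation.Binary using (Rel; IsPartialOrder)
open import Relation.Binary.Lattice.Definitions using (Infimum)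
open import Relation.Binary.PropositionalEquality using (_≡_; _≢_)
open import Relation.Nullary using (¬_; Dec; yes; no; ¬?; does)
open import Relation.Nullary.Decidable using (_×-dec_; _→-dec_; decidable-stable)
open import Relation.Unary using (Pred; Decidable)
open import Algebra.Bundles using (CommutativeRing)

record FinMeetSemilattice (n : ℕ) : Set₁ where
  field
    _≤_            : Rel (Fin n) 0ℓ
    _≤?_           : (x y : Fin n) → Dec (x ≤ y)
    isPartialOrder : IsPartialOrder _≡_ _≤_
    _∧_            : Fin n → Fin n → Fin n
    ∧-infimum      : Infimum _≤_ _∧_
    ⊥              : Fin n
    ⊥-least        : ∀ x → ⊥ ≤ x

allSubsets : ∀ n → List (Subset n)
allSubsets zero    = [] ∷ []
allSubsets (suc n) = map (inside ∷_) (allSubsets n) ++ map (outside ∷_) (allSubsets n)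

allSubsets? : ∀ {n ℓ} {P : Pred (Subset n) ℓ} → Decidable P → Dec (∀ T → P T)
allSubsets? P? with anySubset? (λ T → ¬? (P? T))
... | yes (T , ¬PT) = no (λ all → ¬PT (all T))
... | no ¬∃        = yes (λ T → decidable-stable (P? T) (λ ¬PT → ¬∃ (T , ¬PT)))

signℤ : ℕ → ℤ
signℤ zero    = + 1
signℤ (suc k) = ℤ.- signℤ k

sumℤ : List ℤ → ℤ
sumℤ = foldr ℤ._+_ (+ 0)

module _ {n : ℕ} (L : FinMeetSemilattice n) where
  open FinMeetSemilattice L

  MaxBelow : Subset n → Fin n → Fin n → Set
  MaxBelow G p g = g ∈ G × g ≤ p × (∀ h → h ∈ G → h ≤ p → g ≤ h → h ≡ g)

  maxBelow? : ∀ G p g → Dec (MaxBelow G p g)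
  maxBelow? G p g = (g ∈? G) ×-dec ((g ≤? p) ×-dec
    all? (λ h → (h ∈? G) →-dec ((h ≤? p) →-dec ((g ≤? h) →-dec (h ≟ᶠ g)))))

  Fset : Subset n → Fin n → Subset n
  Fset G p = tabulate (λ g → if does (maxBelow? G p g) then inside else outside)

  -- elements of the product ∏_{g ∈ F_G(p)} [0̂, g], encoded as functions
  -- Fin n → Fin n whose coordinates outside F_G(p) are 0̂
  IsTuple : Subset n → Fin n → (Fin n → Fin n) → Set
  IsTuple G p t = ∀ g → (MaxBelow G p g → t g ≤ g) × (¬ MaxBelow G p g → t g ≡ ⊥)

  IsBuildingSet : Subset n → Set
  IsBuildingSet G = (⊥ ∉ G) × (∀ p → p ≢ ⊥ → Σ[ φ ∈ (Fin n → Fin n → Fin n) ]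
      ((∀ x → x ≤ p → IsTuple G p (φ x))
    × (∀ x y → x ≤ p → y ≤ p →
          (x ≤ y → ∀ g → MaxBelow G p g → φ x g ≤ φ y g)
        × ((∀ g → MaxBelow G p g → φ x g ≤ φ y g) → x ≤ y))
    × (∀ t → IsTuple G p t → Σ[ x ∈ Fin n ] (x ≤ p × (∀ g → MaxBelow G p g → φ x g ≡ t g)))
    × (∀ g → MaxBelow G p g →
          φ g g ≡ g × (∀ h → MaxBelow G p h → h ≢ g → φ g h ≡ ⊥))))

  IsJoin : Subset n → Fin n → Set
  IsJoin T j = (∀ t → t ∈ T → t ≤ j) × (∀ u → (∀ t → t ∈ T → t ≤ u) → j ≤ u)

  isJoin? : ∀ T j → Dec (IsJoin T j)
  isJoin? T j = all? (λ t → (t ∈? T) →-dec (t ≤? j)) ×-dec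
    all? (λ u → all? (λ t → (t ∈? T) →-dec (t ≤? u)) →-dec (j ≤? u))

  PairwiseIncomparable : Subset n → Set
  PairwiseIncomparable T = ∀ x y → x ∈ T → y ∈ T → x ≢ y → ¬ (x ≤ y)

  pairwiseIncomparable? : ∀ T → Dec (PairwiseIncomparable T)
  pairwiseIncomparable? T = all? (λ x → all? (λ y → (x ∈? T) →-dec ((y ∈? T) →-dec
    (¬? (x ≟ᶠ y) →-dec ¬? (x ≤? y)))))

  IsNested : Subset n → Subset n → Set
  IsNested G S = S ⊆ G × (∀ T → T ⊆ S → 2 ℕ.≤ Sub.∣ T ∣ → PairwiseIncomparable T →
                   Σ[ j ∈ Fin n ] (IsJoin T j × j ∉ G))

  nested? : ∀ G S → Dec (IsNested G S)
  nested? G S = (S ⊆? G) ×-dec allSubsets? (λ T → (T ⊆? S) →-dec ((2 ℕ.≤? Sub.∣ T ∣) →-dec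
    (pairwiseIncomparable? T →-dec any? (λ j → isJoin? T j ×-dec ¬? (j ∈? G)))))

  nestedList : Subset n → List (Subset n)
  nestedList G = filter (nested? G) (allSubsets n)

  χ° : Subset n → (Subset n → ℤ) → Subset n → ℤ
  χ° G χ U = sumℤ (map (λ T → signℤ (Sub.∣ T ∣ ℕ.∸ Sub.∣ U ∣) ℤ.* χ T)
                      (filter (U ⊆?_) (nestedList G)))

  Bl : Subset n → Fin n → (Subset n → ℤ) → Subset n → ℤ
  Bl G₁ b f S with b ∈? S | nested? G₁ (S ∪ Fset G₁ b)
  ... | yes _ | _     = f ((S ─ ⁅ b ⁆) ∪ Fset G₁ b) ℤ.* (+ Sub.∣ Fset G₁ b ─ S ∣)
  ... | no _  | yes _ = f S ℤ.+ f (S ∪ Fset G₁ b) ℤ.* ((+ Sub.∣ Fset G₁ b ─ S ∣) ℤ.- + 1)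
  ... | no _  | no _  = f S

  module _ {c ℓ : Level} (R : CommutativeRing c ℓ) where
    open CommutativeRing R renaming (Carrier to A)
    open import Algebra.Definitions.RawMonoid +-rawMonoid using () renaming (_×_ to _·ℕ_)

    ℤ→R : ℤ → A
    ℤ→R (+ k)    = k ·ℕ 1#
    ℤ→R -[1+ k ] = - (suc k ·ℕ 1#)

    sumR : List A → A
    sumR = foldr _+_ 0#

    prodR : List A → A
    prodR = foldr _*_ 1#

    -- Z_L^{G,χ,α} where αinv A is the inverse α(A)⁻¹
    Z : Subset n → (Subset n → ℤ) → (Fin n → A) → A
    Z G χ αinv = sumR (map (λ U → ℤ→R (χ° G χ U) * prodR (map αinv (filter (_∈? U) (allFin n))))
                           (nestedList G))

    sumOverF : Subset n → Fin n → (Fin n → A) → A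
    sumOverF G p α = sumR (map α (filter (maxBelow? G p) (allFin n)))

-- Put z_i = α(i)⁻¹ - 1. Expanding χ° and summing the signs over U ⊆ T turns Z^{G,χ,α} into
-- Σ_{T ∈ N(G)} χ(T) ∏_{i ∈ T} z_i; both sides are compared in this form.
-- Let F = F_{G₁}(b). For b ∉ S: S ∈ N(G₂) iff S ∈ N(G₁) and F ⊄ S, and S ∪ {b} ∈ N(G₂) iff
-- S ∪ F ∈ N(G₁) and F ⊄ S. The key point is that F lies inside every nested antichain joining
-- to b, which follows from the decomposition [0̂, b] ≅ ∏_{f ∈ F} [0̂, f].
-- Hence the T ⊉ F in N(G₁) give the χ(S) part of Bl_b χ. When F ⊆ T, α(b) = Σ_{f ∈ F} α(f) gives
-- ∏_F z = Σ_{C ⊊ F} ((|F ∖ C| - 1) + z_b |F ∖ C|) ∏_C z; regrouping (T, C) by S = (T ∖ F) ∪ C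
-- yields the other two parts of Bl_b χ, the z_b-part being carried by S ∪ {b}.

module Submission where

open import Defs
open import Level using (Level)
open import Algebra.Bundles using (CommutativeRing)
open import Data.Bool using (Bool; true; false; if_then_else_)
open import Data.Empty using (⊥; ⊥-elim)
open import Data.Nat as ℕ using (ℕ; zero; suc)
import Data.Nat.Properties as ℕ
open import Data.Integer as ℤ using (ℤ; +_; -[1+_])
open import Data.Fin using (Fin; zero; suc)
open import Data.Fin.Properties using (all?; any?) renaming (_≟_ to _≟ᶠ_)
open import Data.Fin.Subset as Sub using (Subset; inside; outside; _∈_; _∉_; _⊆_; _∪_; _∩_; _─_; ⁅_⁆; ∣_∣)
open import Data.Fin.Subset.Properties using (_∈?_; _⊆?_; x∈p∪q⁺; x∈p∪q⁻; x∈⁅x⁆; x∈⁅y⁆⇒x≡y)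
open import Data.Product using (∃; _×_; _,_; proj₁; proj₂)
open import Data.Sum using (_⊎_; inj₁; inj₂)
open import Data.Vec using ([]; _∷_; here; there)
open import Relation.Nullary using (¬_; Dec; yes; no; ¬?; does)
open import Relation.Nullary.Decidable using (_×-dec_; _⊎-dec_; _→-dec_; decidable-stable)
open import Relation.Unary using (Pred; Decidable)
open import Relation.Binary.PropositionalEquality as ≡ using (_≡_; _≢_)
import Relation.Binary.Reasoning.Setoid

module IntegerCast {c ℓ : Level} (R : CommutativeRing c ℓ) where

  open CommutativeRing R renaming (Carrier to A)
  open import Algebra.Properties.Monoid.Mult.TCOptimised +-monoid using (1+×; ×-homo-+) renaming (_×_ to _·_)
  open import Algebra.Properties.Semiring.Mult.TCOptimised semiring using (×1-homo-*)
  open import Algebra.Properties.Ring ring using (-0#≈0#; -‿involutive; -‿+-comm; -1*x≈-x; -‿distribʳ-*)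
  open import Algebra.Properties.CommutativeSemigroup +-commutativeSemigroup using () renaming (interchange to +-interchange)
  open import Algebra.Properties.CommutativeSemigroup *-commutativeSemigroup using () renaming (interchange to *-interchange)
  open import Algebra.Solver.Ring.AlmostCommutativeRing using (fromCommutativeRing; _-Raw-AlmostCommutative⟶_)
  import Data.Integer.Properties as ℤ
  open import Data.Integer using (_⊖_)
  open import Data.Sign as Sign using (Sign)
  open import Data.Maybe using (map)
  open import Relation.Nullary.Decidable using (dec⇒maybe)
  open Relation.Binary.Reasoning.Setoid setoid

  -- With the optimised multiple, 1 · x = x holds definitionally, so the solver's constants are exact.
  fromℤ : ℤ → A
  fromℤ (+ k)    = k · 1#
  fromℤ -[1+ k ] = - (suc k · 1#)

  fromℤ-suc : ∀ k → fromℤ (+ suc k) ≈ 1# + fromℤ (+ k)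
  fromℤ-suc k = 1+× k 1#

  fromℤ-neg : ∀ i → fromℤ (ℤ.- i) ≈ - fromℤ i
  fromℤ-neg (+ zero)  = sym -0#≈0#
  fromℤ-neg (+ suc k) = refl
  fromℤ-neg -[1+ k ]  = sym (-‿involutive _)

  fromℤ-⊖ : ∀ m n → fromℤ (m ⊖ n) ≈ m · 1# + - (n · 1#)
  fromℤ-⊖ m zero rewrite ℤ.⊖-≥ {m} {0} ℕ.z≤n =
    sym (trans (+-congˡ -0#≈0#) (+-identityʳ _))
  fromℤ-⊖ zero (suc n) rewrite ℤ.⊖-< {0} {suc n} (ℕ.s≤s ℕ.z≤n) = sym (+-identityˡ _)
  fromℤ-⊖ (suc m) (suc n) rewrite ℤ.[1+m]⊖[1+n]≡m⊖n m n = begin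
    fromℤ (m ⊖ n)                      ≈⟨ fromℤ-⊖ m n ⟩
    m · 1# + - (n · 1#)                ≈⟨ +-identityˡ _ ⟨
    0# + (m · 1# + - (n · 1#))         ≈⟨ +-congʳ (-‿inverseʳ 1#) ⟨
    (1# + - 1#) + (m · 1# + - (n · 1#)) ≈⟨ +-interchange _ _ _ _ ⟩
    (1# + m · 1#) + (- 1# + - (n · 1#)) ≈⟨ +-congˡ (-‿+-comm _ _) ⟩
    (1# + m · 1#) + - (1# + n · 1#)    ≈⟨ +-cong (1+× m 1#) (-‿cong (1+× n 1#)) ⟨
    suc m · 1# + - (suc n · 1#)        ∎

  fromℤ-+ : ∀ i j → fromℤ (i ℤ.+ j) ≈ fromℤ i + fromℤ j
  fromℤ-+ (+ m)    (+ n)    = ×-homo-+ 1# m n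
  fromℤ-+ (+ m)    -[1+ n ] = fromℤ-⊖ m (suc n)
  fromℤ-+ -[1+ m ] (+ n)    = trans (fromℤ-⊖ n (suc m)) (+-comm _ _)
  fromℤ-+ -[1+ m ] -[1+ n ] = begin
    - (suc (suc (m ℕ.+ n)) · 1#)        ≡⟨ ≡.cong (λ k → - (suc k · 1#)) (ℕ.+-suc m n) ⟨
    - ((suc m ℕ.+ suc n) · 1#)          ≈⟨ -‿cong (×-homo-+ 1# (suc m) (suc n)) ⟩
    - (suc m · 1# + suc n · 1#)         ≈⟨ -‿+-comm _ _ ⟨
    - (suc m · 1#) + - (suc n · 1#)     ∎

  fromSign : Sign → A
  fromSign Sign.+ = 1#
  fromSign Sign.- = - 1#

  fromSign-* : ∀ s t → fromSign (s Sign.* t) ≈ fromSign s * fromSign t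
  fromSign-* Sign.+ t       = sym (*-identityˡ _)
  fromSign-* Sign.- Sign.+  = sym (*-identityʳ _)
  fromSign-* Sign.- Sign.-  = begin
    1#              ≈⟨ -‿involutive 1# ⟨
    - - 1#          ≈⟨ -‿cong (-1*x≈-x 1#) ⟨
    - (- 1# * 1#)   ≈⟨ -‿distribʳ-* _ _ ⟩
    - 1# * - 1#     ∎

  fromℤ-◃ : ∀ s k → fromℤ (s ℤ.◃ k) ≈ fromSign s * (k · 1#)
  fromℤ-◃ s      zero    = sym (zeroʳ _)
  fromℤ-◃ Sign.+ (suc k) = sym (*-identityˡ _)
  fromℤ-◃ Sign.- (suc k) = sym (-1*x≈-x _)

  fromℤ-signAbs : ∀ i → fromℤ i ≈ fromSign (ℤ.sign i) * (ℤ.∣ i ∣ · 1#)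
  fromℤ-signAbs i = trans (reflexive (≡.cong fromℤ (≡.sym (ℤ.◃-inverse i)))) (fromℤ-◃ (ℤ.sign i) ℤ.∣ i ∣)

  fromℤ-* : ∀ i j → fromℤ (i ℤ.* j) ≈ fromℤ i * fromℤ j
  fromℤ-* i j = begin
    fromℤ (i ℤ.* j)
      ≈⟨ fromℤ-◃ (ℤ.sign i Sign.* ℤ.sign j) (ℤ.∣ i ∣ ℕ.* ℤ.∣ j ∣) ⟩
    fromSign (ℤ.sign i Sign.* ℤ.sign j) * ((ℤ.∣ i ∣ ℕ.* ℤ.∣ j ∣) · 1#)
      ≈⟨ *-cong (fromSign-* (ℤ.sign i) (ℤ.sign j)) (×1-homo-* ℤ.∣ i ∣ ℤ.∣ j ∣) ⟩
    (fromSign (ℤ.sign i) * fromSign (ℤ.sign j)) * ((ℤ.∣ i ∣ · 1#) * (ℤ.∣ j ∣ · 1#))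
      ≈⟨ *-interchange _ _ _ _ ⟩
    (fromSign (ℤ.sign i) * (ℤ.∣ i ∣ · 1#)) * (fromSign (ℤ.sign j) * (ℤ.∣ j ∣ · 1#))
      ≈⟨ *-cong (fromℤ-signAbs i) (fromℤ-signAbs j) ⟨
    fromℤ i * fromℤ j ∎

  fromℤ-morphism : CommutativeRing.rawRing ℤ.+-*-commutativeRing -Raw-AlmostCommutative⟶ fromCommutativeRing R
  fromℤ-morphism = record
    { ⟦_⟧    = fromℤ
    ; +-homo = fromℤ-+
    ; *-homo = fromℤ-*
    ; -‿homo = fromℤ-neg
    ; 0-homo = refl
    ; 1-homo = refl
    }

  open import Algebra.Solver.Ring (CommutativeRing.rawRing ℤ.+-*-commutativeRing) (fromCommutativeRing R)
    fromℤ-morphism (λ i j → map (λ i≡j → reflexive (≡.cong fromℤ i≡j)) (dec⇒maybe (i ℤ.≟ j)))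
    public using (solve; _:+_; _:*_; :-_; _:=_; con)

module SubsetCardinality {n : ℕ} where

  open import Data.Fin.Subset.Properties using (p⊆q⇒∣p∣≤∣q∣; ∣⁅x⁆∣≡1; x∈p∧x≢y⇒x∈p-y; x∈p⇒∣p-x∣<∣p∣)

  ∈⇒1≤∣p∣ : ∀ {x : Fin n} {p} → x ∈ p → 1 ℕ.≤ ∣ p ∣
  ∈⇒1≤∣p∣ {x} {p} x∈p = ≡.subst (ℕ._≤ ∣ p ∣) (∣⁅x⁆∣≡1 x)
    (p⊆q⇒∣p∣≤∣q∣ (λ y∈⁅x⁆ → ≡.subst (_∈ p) (≡.sym (x∈⁅y⁆⇒x≡y x y∈⁅x⁆)) x∈p))

  ∈×∈⇒2≤∣p∣ : ∀ {x y : Fin n} {p} → x ∈ p → y ∈ p → x ≢ y → 2 ℕ.≤ ∣ p ∣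
  ∈×∈⇒2≤∣p∣ x∈p y∈p x≢y =
    ℕ.≤-trans (ℕ.s≤s (∈⇒1≤∣p∣ (x∈p∧x≢y⇒x∈p-y y∈p (λ y≡x → x≢y (≡.sym y≡x))))) (x∈p⇒∣p-x∣<∣p∣ x∈p)

  2≤∣p∣⇒∃≢ : ∀ {p} (x : Fin n) → 2 ℕ.≤ ∣ p ∣ → ∃ λ y → y ∈ p × y ≢ x
  2≤∣p∣⇒∃≢ {p} x 2≤∣p∣ with any? (λ y → (y ∈? p) ×-dec ¬? (y ≟ᶠ x))
  ... | yes other = other
  ... | no ¬other = ⊥-elim (ℕ.<-irrefl ≡.refl (ℕ.≤-trans 2≤∣p∣ ∣p∣≤1))
    where
    p⊆⁅x⁆ : p ⊆ ⁅ x ⁆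
    p⊆⁅x⁆ {y} y∈p = ≡.subst (_∈ ⁅ x ⁆) (≡.sym (decidable-stable (y ≟ᶠ x) (λ y≢x → ¬other (y , y∈p , y≢x)))) (x∈⁅x⁆ x)
    ∣p∣≤1 : ∣ p ∣ ℕ.≤ 1
    ∣p∣≤1 = ≡.subst (∣ p ∣ ℕ.≤_) (∣⁅x⁆∣≡1 x) (p⊆q⇒∣p∣≤∣q∣ p⊆⁅x⁆)

module Comprehension {n : ℕ} where

  open import Data.Vec using (tabulate; lookup)
  open import Data.Vec.Properties using (lookup∘tabulate; []=⇒lookup; lookup⇒[]=)

  select : ∀ {p} {P : Pred (Fin n) p} → Decidable P → Subset n
  select P? = tabulate (λ x → if does (P? x) then inside else outside)

  module _ {p} {P : Pred (Fin n) p} (P? : Decidable P) {x : Fin n} where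

    private
      lookup-select : lookup (select P?) x ≡ (if does (P? x) then inside else outside)
      lookup-select = lookup∘tabulate _ x

    ∈-select⁺ : P x → x ∈ select P?
    ∈-select⁺ px = lookup⇒[]= x (select P?) (≡.trans lookup-select (holds (P? x) px))
      where
      holds : (d : Dec (P x)) → P x → (if does d then inside else outside) ≡ inside
      holds (yes _) _  = ≡.refl
      holds (no ¬px) px = ⊥-elim (¬px px)

    ∈-select⁻ : x ∈ select P? → P x
    ∈-select⁻ x∈ = holds (P? x) (≡.trans (≡.sym lookup-select) ([]=⇒lookup x∈))
      where
      holds : (d : Dec (P x)) → (if does d then inside else outside) ≡ inside → P x
      holds (yes px) _ = px
      holds (no _)  ()

module Order {n : ℕ} (L : FinMeetSemilattice n) where

  open FinMeetSemilattice L renaming (⊥ to 0̂)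
  open import Relation.Binary.Structures using (IsPartialOrder)
  open IsPartialOrder isPartialOrder public
    using () renaming (refl to ≤-refl; trans to ≤-trans; antisym to ≤-antisym)
  open import Data.Nat.Induction using (<-wellFounded)
  open import Induction.WellFounded using (Acc; acc)
  open import Data.Fin.Subset.Properties using (p⊂q⇒∣p∣<∣q∣; nonempty?)
  open import Data.List using (List; []; _∷_; allFin)
  open import Data.List.Membership.Propositional using () renaming (_∈_ to _∈ₗ_)
  open import Data.List.Membership.Propositional.Properties using (∈-allFin)
  open import Data.List.Relation.Unary.Any using (here; there)
  open Comprehension
  open SubsetCardinality

  ≤0̂⇒≡0̂ : ∀ {x} → x ≤ 0̂ → x ≡ 0̂
  ≤0̂⇒≡0̂ x≤0̂ = ≤-antisym x≤0̂ (⊥-least _)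

  join-unique : ∀ {T j j′} → IsJoin L T j → IsJoin L T j′ → j ≡ j′
  join-unique (ub , least) (ub′ , least′) = ≤-antisym (least _ ub′) (least′ _ ub)

  infixl 5 _↓_

  _↓_ : Subset n → Fin n → Subset n
  T ↓ f = select (λ t → (t ∈? T) ×-dec (t ≤? f))

  ∈↓⁺ : ∀ {T f t} → t ∈ T → t ≤ f → t ∈ T ↓ f
  ∈↓⁺ {T} {f} t∈T t≤f = ∈-select⁺ (λ t → (t ∈? T) ×-dec (t ≤? f)) (t∈T , t≤f)

  ∈↓⁻ : ∀ {T f t} → t ∈ T ↓ f → t ∈ T × t ≤ f
  ∈↓⁻ {T} {f} = ∈-select⁻ (λ t → (t ∈? T) ×-dec (t ≤? f))

  module _ (T : Subset n) where

    UpperBound : Fin n → Set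
    UpperBound u = ∀ t → t ∈ T → t ≤ u

    private
      upperBound? : ∀ u → Dec (UpperBound u)
      upperBound? u = all? (λ t → (t ∈? T) →-dec (t ≤? u))

      meetUpperBounds : Fin n → List (Fin n) → Fin n
      meetUpperBounds u []       = u
      meetUpperBounds u (v ∷ vs) with upperBound? v
      ... | yes _ = v ∧ meetUpperBounds u vs
      ... | no _  = meetUpperBounds u vs

      meetUpperBounds-upper : ∀ {u} → UpperBound u → ∀ vs → UpperBound (meetUpperBounds u vs)
      meetUpperBounds-upper ub-u []       = ub-u
      meetUpperBounds-upper ub-u (v ∷ vs) with upperBound? v
      ... | yes ub-v = λ t t∈ → proj₂ (proj₂ (∧-infimum v _)) t (ub-v t t∈) (meetUpperBounds-upper ub-u vs t t∈)
      ... | no _     = meetUpperBounds-upper ub-u vs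

      meetUpperBounds-least : ∀ {u v} vs → v ∈ₗ vs → UpperBound v → meetUpperBounds u vs ≤ v
      meetUpperBounds-least (w ∷ vs) v∈ ub-v with upperBound? w | v∈
      ... | yes _     | here ≡.refl = proj₁ (∧-infimum w _)
      ... | no ¬ub-w  | here ≡.refl = ⊥-elim (¬ub-w ub-v)
      ... | yes _     | there v∈vs  = ≤-trans (proj₁ (proj₂ (∧-infimum w _))) (meetUpperBounds-least vs v∈vs ub-v)
      ... | no _      | there v∈vs  = meetUpperBounds-least vs v∈vs ub-v

    bounded⇒join : ∀ {u} → UpperBound u → ∃ (IsJoin L T)
    bounded⇒join {u} ub-u = meetUpperBounds u (allFin n)
      , meetUpperBounds-upper ub-u (allFin n)
      , λ v ub-v → meetUpperBounds-least (allFin n) (∈-allFin v) ub-v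

  module _ (G : Subset n) (p : Fin n) where

    below-maximal : ∀ {g} → g ∈ G → g ≤ p → ∃ λ m → MaxBelow L G p m × g ≤ m
    below-maximal {g} = go g (<-wellFounded _)
      where
      ↑ : Fin n → Subset n
      ↑ h = select (h ≤?_)

      go : ∀ g → Acc ℕ._<_ ∣ ↑ g ∣ → g ∈ G → g ≤ p → ∃ λ m → MaxBelow L G p m × g ≤ m
      go g (acc rec) g∈G g≤p with any? (λ h → (h ∈? G) ×-dec ((h ≤? p) ×-dec ((g ≤? h) ×-dec ¬? (h ≟ᶠ g))))
      ... | no ¬above = g , (g∈G , g≤p , maximal) , ≤-refl
        where
        maximal : ∀ h → h ∈ G → h ≤ p → g ≤ h → h ≡ g
        maximal h h∈G h≤p g≤h = decidable-stable (h ≟ᶠ g) (λ h≢g → ¬above (h , h∈G , h≤p , g≤h , h≢g))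
      ... | yes (h , h∈G , h≤p , g≤h , h≢g) with go h (rec ↑h⊂↑g) h∈G h≤p
        where
        ↑h⊂↑g : ∣ ↑ h ∣ ℕ.< ∣ ↑ g ∣
        ↑h⊂↑g = p⊂q⇒∣p∣<∣q∣
          ( (λ x∈↑h → ∈-select⁺ (g ≤?_) (≤-trans g≤h (∈-select⁻ (h ≤?_) x∈↑h)))
          , g , ∈-select⁺ (g ≤?_) ≤-refl , λ g∈↑h → h≢g (≤-antisym (∈-select⁻ (h ≤?_) g∈↑h) g≤h))
      ... | m , m-max , h≤m = m , m-max , ≤-trans g≤h h≤m

  maxBelow-∈ : ∀ {G p g} → MaxBelow L G p g → g ∈ G
  maxBelow-∈ = proj₁

  maxBelow-≤ : ∀ {G p g} → MaxBelow L G p g → g ≤ p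
  maxBelow-≤ = λ m → proj₁ (proj₂ m)

  maxBelow-maximal : ∀ {G p g h} → MaxBelow L G p g → h ∈ G → h ≤ p → g ≤ h → h ≡ g
  maxBelow-maximal m h∈G h≤p g≤h = proj₂ (proj₂ m) _ h∈G h≤p g≤h

  nested-⊆ : ∀ {G S U} → IsNested L G S → U ⊆ S → IsNested L G U
  nested-⊆ (S⊆G , joins) U⊆S = (λ x∈U → S⊆G (U⊆S x∈U)) , (λ T T⊆U → joins T (λ x∈T → U⊆S (T⊆U x∈T)))

  nested-join∈G⇒∈ : ∀ {G S T j} → 0̂ ∉ G → IsNested L G S → T ⊆ S → PairwiseIncomparable L T →
                    IsJoin L T j → j ∈ G → j ∈ T
  nested-join∈G⇒∈ {G} {S} {T} {j} 0̂∉G (_ , joins) T⊆S antichain (ub , least) j∈G with 2 ℕ.≤? ∣ T ∣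
  ... | yes 2≤∣T∣ = ⊥-elim (j∉G (joins T T⊆S 2≤∣T∣ antichain))
    where
    j∉G : ∃ (λ j′ → IsJoin L T j′ × j′ ∉ G) → ⊥
    j∉G (j′ , j′-join , j′∉G) = j′∉G (≡.subst (_∈ G) (join-unique (ub , least) j′-join) j∈G)
  ... | no ¬2≤∣T∣ with nonempty? T
  ...   | no empty = ⊥-elim (0̂∉G (≡.subst (_∈ G) (≤0̂⇒≡0̂ (least 0̂ (λ t t∈T → ⊥-elim (empty (t , t∈T))))) j∈G))
  ...   | yes (t , t∈T) = ≡.subst (_∈ T) (≤-antisym (ub t t∈T) (least t t-upper)) t∈T
    where
    t-upper : UpperBound T t
    t-upper t′ t′∈T = ≡.subst (_≤ t) (≡.sym t′≡t) ≤-refl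
      where
      t′≡t = decidable-stable (t′ ≟ᶠ t) (λ t′≢t → ¬2≤∣T∣ (∈×∈⇒2≤∣p∣ t′∈T t∈T t′≢t))

  module BuildingSet (G : Subset n) (G-building : IsBuildingSet L G) (p : Fin n) (p≢0̂ : p ≢ 0̂) where

    Factor : Fin n → Set
    Factor = MaxBelow L G p

    factors : Subset n
    factors = Fset L G p

    ∈factors⁺ : ∀ {g} → Factor g → g ∈ factors
    ∈factors⁺ = ∈-select⁺ (maxBelow? L G p)

    ∈factors⁻ : ∀ {g} → g ∈ factors → Factor g
    ∈factors⁻ = ∈-select⁻ (maxBelow? L G p)

    private
      decomposition = proj₂ G-building p p≢0̂

    φ : Fin n → Fin n → Fin n
    φ = proj₁ decomposition

    φ-tuple : ∀ {x} → x ≤ p → IsTuple L G p (φ x)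
    φ-tuple = proj₁ (proj₂ decomposition) _

    φ-mono : ∀ {x y} → x ≤ y → y ≤ p → ∀ g → Factor g → φ x g ≤ φ y g
    φ-mono x≤y y≤p = proj₁ (proj₁ (proj₂ (proj₂ decomposition)) _ _ (≤-trans x≤y y≤p) y≤p) x≤y

    φ-reflects : ∀ {x y} → x ≤ p → y ≤ p → (∀ g → Factor g → φ x g ≤ φ y g) → x ≤ y
    φ-reflects x≤p y≤p = proj₂ (proj₁ (proj₂ (proj₂ decomposition)) _ _ x≤p y≤p)

    φ-onto : ∀ t → IsTuple L G p t → ∃ λ x → x ≤ p × (∀ g → Factor g → φ x g ≡ t g)
    φ-onto = proj₁ (proj₂ (proj₂ (proj₂ decomposition)))

    φ-factor-diag : ∀ {g} → Factor g → φ g g ≡ g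
    φ-factor-diag g-fac = proj₁ (proj₂ (proj₂ (proj₂ (proj₂ decomposition))) _ g-fac)

    φ-factor-off : ∀ {g h} → Factor g → Factor h → h ≢ g → φ g h ≡ 0̂
    φ-factor-off g-fac h-fac h≢g = proj₂ (proj₂ (proj₂ (proj₂ (proj₂ decomposition))) _ g-fac) _ h-fac h≢g

    φ≤factor : ∀ {x} → x ≤ p → ∀ g → Factor g → φ x g ≤ g
    φ≤factor x≤p g g-fac = proj₁ (φ-tuple x≤p g) g-fac

    factor≤φ : ∀ {x g} → Factor g → g ≤ x → x ≤ p → g ≤ φ x g
    factor≤φ {x} {g} g-fac g≤x x≤p = ≡.subst (_≤ φ x g) (φ-factor-diag g-fac) (φ-mono g≤x x≤p g g-fac)

    φ-top : ∀ g → Factor g → φ p g ≡ g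
    φ-top g g-fac = ≤-antisym (φ≤factor ≤-refl g g-fac) (factor≤φ g-fac (maxBelow-≤ g-fac) ≤-refl)

    below-two-factors⇒0̂ : ∀ {x f f′} → Factor f → Factor f′ → f ≢ f′ → x ≤ f → x ≤ f′ → x ≡ 0̂
    below-two-factors⇒0̂ {x} {f} {f′} f-fac f′-fac f≢f′ x≤f x≤f′ =
      ≤0̂⇒≡0̂ (φ-reflects (≤-trans x≤f (maxBelow-≤ f-fac)) (⊥-least p) λ g g-fac → ≤-trans (φx≤0̂ g g-fac) (⊥-least _))
      where
      φx≤0̂ : ∀ g → Factor g → φ x g ≤ 0̂
      φx≤0̂ g g-fac with g ≟ᶠ f
      ... | yes ≡.refl = ≡.subst (φ x g ≤_) (φ-factor-off f′-fac g-fac f≢f′) (φ-mono x≤f′ (maxBelow-≤ f′-fac) g g-fac)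
      ... | no g≢f     = ≡.subst (φ x g ≤_) (φ-factor-off f-fac g-fac g≢f) (φ-mono x≤f (maxBelow-≤ f-fac) g g-fac)

    factors-join : IsJoin L factors p
    factors-join = (λ f f∈ → maxBelow-≤ (∈factors⁻ f∈)) , least
      where
      least : ∀ u → UpperBound factors u → p ≤ u
      least u ub = ≤-trans p≤p∧u (proj₁ (proj₂ (∧-infimum p u)))
        where
        p∧u≤p : (p ∧ u) ≤ p
        p∧u≤p = proj₁ (∧-infimum p u)
        p≤p∧u : p ≤ (p ∧ u)
        p≤p∧u = φ-reflects ≤-refl p∧u≤p λ g g-fac → ≡.subst (_≤ φ (p ∧ u) g) (≡.sym (φ-top g g-fac))
          (factor≤φ g-fac (proj₂ (proj₂ (∧-infimum p u)) g (maxBelow-≤ g-fac) (ub g (∈factors⁺ g-fac))) p∧u≤p)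

    factors-antichain : PairwiseIncomparable L factors
    factors-antichain f f′ f∈ f′∈ f≢f′ f≤f′ =
      f≢f′ (≡.sym (maxBelow-maximal (∈factors⁻ f∈) (maxBelow-∈ f′-fac) (maxBelow-≤ f′-fac) f≤f′))
      where f′-fac = ∈factors⁻ f′∈

    -- With j the join of T ↓ f: the element with coordinates φ j at f and φ p elsewhere bounds T,
    -- hence lies above p; comparing f-coordinates gives f ≤ φ j f, i.e. f ≤ j.
    module _ {T : Subset n} (T-join : IsJoin L T p) (T-factored : ∀ {t} → t ∈ T → ∃ λ m → Factor m × t ≤ m)
             {f : Fin n} (f-fac : Factor f) where

      private
        T↓f-join = bounded⇒join (T ↓ f) (λ t t∈ → proj₂ (∈↓⁻ t∈))
        j = proj₁ T↓f-join
        j-join = proj₂ T↓f-join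
        j≤f : j ≤ f
        j≤f = proj₂ j-join f (λ t t∈ → proj₂ (∈↓⁻ t∈))
        j≤p : j ≤ p
        j≤p = ≤-trans j≤f (maxBelow-≤ f-fac)

        w : ∀ g → Dec (g ≡ f) → Fin n
        w g (yes _) = φ j f
        w g (no _)  = φ p g

        w-tuple : ∀ g (d : Dec (g ≡ f)) → (Factor g → w g d ≤ g) × (¬ Factor g → w g d ≡ 0̂)
        w-tuple g (yes ≡.refl) = (λ _ → φ≤factor j≤p f f-fac) , (λ ¬fac → ⊥-elim (¬fac f-fac))
        w-tuple g (no _)       = φ-tuple ≤-refl g

        x-props = φ-onto (λ g → w g (g ≟ᶠ f)) (λ g → w-tuple g (g ≟ᶠ f))
        x = proj₁ x-props
        x≤p = proj₁ (proj₂ x-props)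
        φx≡w = proj₂ (proj₂ x-props)

        φt≤w : ∀ {t m} → t ∈ T → Factor m → t ≤ m → ∀ g → Factor g → (d : Dec (g ≡ f)) → φ t g ≤ w g d
        φt≤w {t} {m} t∈T m-fac t≤m g g-fac (yes ≡.refl) with m ≟ᶠ f
        ... | yes ≡.refl = φ-mono (proj₁ j-join t (∈↓⁺ t∈T t≤m)) j≤p f f-fac
        ... | no m≢f     = ≤-trans (φ-mono t≤m (maxBelow-≤ m-fac) f f-fac)
                             (≡.subst (_≤ φ j f) (≡.sym (φ-factor-off m-fac f-fac (λ f≡m → m≢f (≡.sym f≡m)))) (⊥-least _))
        φt≤w t∈T m-fac t≤m g g-fac (no _) = φ-mono (proj₁ T-join _ t∈T) ≤-refl g g-fac

        T≤x : UpperBound T x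
        T≤x t t∈T with T-factored t∈T
        ... | m , m-fac , t≤m = φ-reflects (proj₁ T-join t t∈T) x≤p
          λ g g-fac → ≡.subst (φ t g ≤_) (≡.sym (φx≡w g g-fac)) (φt≤w t∈T m-fac t≤m g g-fac (g ≟ᶠ f))

        w-at-f : (d : Dec (f ≡ f)) → w f d ≡ φ j f
        w-at-f (yes _)  = ≡.refl
        w-at-f (no f≢f) = ⊥-elim (f≢f ≡.refl)

        f≤φjf : f ≤ φ j f
        f≤φjf = ≡.subst₂ _≤_ (φ-top f f-fac) (≡.trans (φx≡w f f-fac) (w-at-f (f ≟ᶠ f)))
                  (φ-mono (proj₂ T-join x T≤x) x≤p f f-fac)

        φf≤φj : ∀ g → Factor g → Dec (g ≡ f) → φ f g ≤ φ j g
        φf≤φj g g-fac (yes ≡.refl) = ≡.subst (_≤ φ j f) (≡.sym (φ-factor-diag f-fac)) f≤φjf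
        φf≤φj g g-fac (no g≢f)     = ≡.subst (_≤ φ j g) (≡.sym (φ-factor-off f-fac g-fac g≢f)) (⊥-least _)

      factor-join-↓ : IsJoin L (T ↓ f) f
      factor-join-↓ = ≡.subst (IsJoin L (T ↓ f))
        (≤-antisym j≤f (φ-reflects (maxBelow-≤ f-fac) j≤p (λ g g-fac → φf≤φj g g-fac (g ≟ᶠ f)))) j-join

module Blowup {n : ℕ} (L : FinMeetSemilattice n) (G₁ : Subset n) (b : Fin n) (b∉G₁ : b ∉ G₁)
              (G₁-building : IsBuildingSet L G₁) (G₂-building : IsBuildingSet L (G₁ ∪ ⁅ b ⁆)) where

  open FinMeetSemilattice L renaming (⊥ to 0̂)
  open Order L
  open SubsetCardinality
  open Comprehension
  open import Function.Bundles using (_⇔_; mk⇔)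

  G₂ : Subset n
  G₂ = G₁ ∪ ⁅ b ⁆

  0̂∉G₁ : 0̂ ∉ G₁
  0̂∉G₁ = proj₁ G₁-building

  0̂∉G₂ : 0̂ ∉ G₂
  0̂∉G₂ = proj₁ G₂-building

  b∈G₂ : b ∈ G₂
  b∈G₂ = x∈p∪q⁺ (inj₂ (x∈⁅x⁆ b))

  G₁⊆G₂ : G₁ ⊆ G₂
  G₁⊆G₂ x∈G₁ = x∈p∪q⁺ (inj₁ x∈G₁)

  ∈G₂⇒∈G₁⊎≡b : ∀ {x} → x ∈ G₂ → x ∈ G₁ ⊎ x ≡ b
  ∈G₂⇒∈G₁⊎≡b x∈G₂ with x∈p∪q⁻ G₁ ⁅ b ⁆ x∈G₂
  ... | inj₁ x∈G₁  = inj₁ x∈G₁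
  ... | inj₂ x∈⁅b⁆ = inj₂ (x∈⁅y⁆⇒x≡y b x∈⁅b⁆)

  ∉G₁×≢b⇒∉G₂ : ∀ {x} → x ∉ G₁ → x ≢ b → x ∉ G₂
  ∉G₁×≢b⇒∉G₂ x∉G₁ x≢b x∈G₂ with ∈G₂⇒∈G₁⊎≡b x∈G₂
  ... | inj₁ x∈G₁ = x∉G₁ x∈G₁
  ... | inj₂ x≡b  = x≢b x≡b

  ⊆G₂×∌b⇒⊆G₁ : ∀ {S} → S ⊆ G₂ → b ∉ S → S ⊆ G₁
  ⊆G₂×∌b⇒⊆G₁ S⊆G₂ b∉S x∈S with ∈G₂⇒∈G₁⊎≡b (S⊆G₂ x∈S)
  ... | inj₁ x∈G₁   = x∈G₁
  ... | inj₂ ≡.refl = ⊥-elim (b∉S x∈S)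

  join∉G₂⇒join∉G₁ : ∀ {T} → ∃ (λ j → IsJoin L T j × j ∉ G₂) → ∃ (λ j → IsJoin L T j × j ∉ G₁)
  join∉G₂⇒join∉G₁ (j , j-join , j∉G₂) = j , j-join , λ j∈G₁ → j∉G₂ (G₁⊆G₂ j∈G₁)

  b≢0̂ : b ≢ 0̂
  b≢0̂ b≡0̂ = 0̂∉G₂ (≡.subst (_∈ G₂) b≡0̂ b∈G₂)

  open BuildingSet G₁ G₁-building b b≢0̂ renaming (factors to F) public

  F⊆G₁ : F ⊆ G₁
  F⊆G₁ f∈F = maxBelow-∈ (∈factors⁻ f∈F)

  b∉F : b ∉ F
  b∉F b∈F = b∉G₁ (F⊆G₁ b∈F)

  nested₁-b∉ : ∀ {S} → IsNested L G₁ S → b ∉ S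
  nested₁-b∉ (S⊆G₁ , _) b∈S = b∉G₁ (S⊆G₁ b∈S)

  nested₂-F⊈ : ∀ {S} → IsNested L G₂ S → ¬ (F ⊆ S)
  nested₂-F⊈ S-nested F⊆S =
    b∉F (nested-join∈G⇒∈ 0̂∉G₂ S-nested F⊆S factors-antichain factors-join b∈G₂)

  F⊆antichain-joining-b : ∀ {S T} → IsNested L G₁ S → T ⊆ S → PairwiseIncomparable L T → IsJoin L T b → F ⊆ T
  F⊆antichain-joining-b {S} {T} S-nested T⊆S antichain T-join {f} f∈F =
    proj₁ (∈↓⁻ (nested-join∈G⇒∈ 0̂∉G₁ S-nested (λ t∈ → T⊆S (proj₁ (∈↓⁻ t∈))) ↓-antichain
                  (factor-join-↓ T-join T-factored f-fac) (maxBelow-∈ f-fac)))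
    where
    f-fac = ∈factors⁻ f∈F
    T-factored : ∀ {t} → t ∈ T → ∃ λ m → Factor m × t ≤ m
    T-factored t∈T = below-maximal G₁ b (proj₁ S-nested (T⊆S t∈T)) (proj₁ T-join _ t∈T)
    ↓-antichain : PairwiseIncomparable L (T ↓ f)
    ↓-antichain x y x∈ y∈ = antichain x y (proj₁ (∈↓⁻ x∈)) (proj₁ (∈↓⁻ y∈))

  nested₂⇒nested₁ : ∀ {S} → b ∉ S → IsNested L G₂ S → IsNested L G₁ S
  nested₂⇒nested₁ b∉S (S⊆G₂ , joins₂) =
    ⊆G₂×∌b⇒⊆G₁ S⊆G₂ b∉S , λ T T⊆S 2≤∣T∣ antichain → join∉G₂⇒join∉G₁ (joins₂ T T⊆S 2≤∣T∣ antichain)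

  nested₁⇒nested₂ : ∀ {S} → IsNested L G₁ S → ¬ (F ⊆ S) → IsNested L G₂ S
  nested₁⇒nested₂ {S} S-nested₁@(S⊆G₁ , joins₁) F⊈S = (λ x∈S → G₁⊆G₂ (S⊆G₁ x∈S)) , joins₂
    where
    joins₂ : ∀ T → T ⊆ S → 2 ℕ.≤ ∣ T ∣ → PairwiseIncomparable L T → ∃ λ j → IsJoin L T j × j ∉ G₂
    joins₂ T T⊆S 2≤∣T∣ antichain with joins₁ T T⊆S 2≤∣T∣ antichain
    ... | j , j-join , j∉G₁ = j , j-join , ∉G₁×≢b⇒∉G₂ j∉G₁ λ { ≡.refl →
          F⊈S (λ f∈F → T⊆S (F⊆antichain-joining-b S-nested₁ T⊆S antichain j-join f∈F)) }

  join∉G₁-below-b : ∀ {T f} → PairwiseIncomparable L T → 2 ℕ.≤ ∣ T ∣ → f ∈ T → Factor f → UpperBound T b →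
                    ∃ λ j → IsJoin L T j × j ∉ G₁
  join∉G₁-below-b {T} {f} antichain 2≤∣T∣ f∈T f-fac T≤b with bounded⇒join T T≤b
  ... | g , g-join = g , g-join , g∉G₁
    where
    g∉G₁ : g ∉ G₁
    g∉G₁ g∈G₁ with below-maximal G₁ b g∈G₁ (proj₂ g-join b T≤b) | 2≤∣p∣⇒∃≢ f 2≤∣T∣
    ... | f′ , f′-fac , g≤f′ | t , t∈T , t≢f = antichain t f t∈T f∈T t≢f (≡.subst (t ≤_) f′≡f t≤f′)
      where
      t≤f′ = ≤-trans (proj₁ g-join t t∈T) g≤f′
      f′≡f = maxBelow-maximal f-fac (maxBelow-∈ f′-fac) (maxBelow-≤ f′-fac) (≤-trans (proj₁ g-join f f∈T) g≤f′)

  module ReplaceBelowByB {S T f a} (S∪b-nested₂ : IsNested L G₂ (S ∪ ⁅ b ⁆)) (T⊆S∪F : T ⊆ S ∪ F)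
                         (antichain : PairwiseIncomparable L T) (f∈T : f ∈ T) (f-fac : Factor f)
                         (a∈T : a ∈ T) (a≰b : ¬ a ≤ b) where

    X? : ∀ t → Dec ((t ∈ T × ¬ t ≤ b) ⊎ t ≡ b)
    X? t = ((t ∈? T) ×-dec ¬? (t ≤? b)) ⊎-dec (t ≟ᶠ b)
    X = select X?

    X⊆S∪b : X ⊆ S ∪ ⁅ b ⁆
    X⊆S∪b t∈X with ∈-select⁻ X? t∈X
    ... | inj₂ ≡.refl = x∈p∪q⁺ (inj₂ (x∈⁅x⁆ b))
    ... | inj₁ (t∈T , t≰b) with x∈p∪q⁻ S F (T⊆S∪F t∈T)
    ...   | inj₁ t∈S = x∈p∪q⁺ (inj₁ t∈S)
    ...   | inj₂ t∈F = ⊥-elim (t≰b (maxBelow-≤ (∈factors⁻ t∈F)))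

    2≤∣X∣ : 2 ℕ.≤ ∣ X ∣
    2≤∣X∣ = ∈×∈⇒2≤∣p∣ (∈-select⁺ X? (inj₁ (a∈T , a≰b))) (∈-select⁺ X? (inj₂ ≡.refl))
              (λ a≡b → a≰b (≡.subst (_≤ b) (≡.sym a≡b) ≤-refl))

    X-antichain : PairwiseIncomparable L X
    X-antichain x y x∈X y∈X x≢y x≤y with ∈-select⁻ X? x∈X | ∈-select⁻ X? y∈X
    ... | inj₁ (x∈T , _)   | inj₁ (y∈T , _)   = antichain x y x∈T y∈T x≢y x≤y
    ... | inj₁ (_ , x≰b)   | inj₂ ≡.refl      = x≰b x≤y
    ... | inj₂ ≡.refl      | inj₁ (y∈T , y≰b) =
      antichain f y f∈T y∈T (λ f≡y → y≰b (≡.subst (_≤ b) f≡y (maxBelow-≤ f-fac))) (≤-trans (maxBelow-≤ f-fac) x≤y)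
    ... | inj₂ ≡.refl      | inj₂ ≡.refl      = x≢y ≡.refl

    q-props = proj₂ S∪b-nested₂ X X⊆S∪b 2≤∣X∣ X-antichain
    q = proj₁ q-props
    q-join = proj₁ (proj₂ q-props)
    q∉G₂ = proj₂ (proj₂ q-props)

    b≤q : b ≤ q
    b≤q = proj₁ q-join b (∈-select⁺ X? (inj₂ ≡.refl))

    T≤q : UpperBound T q
    T≤q t t∈T with t ≤? b
    ... | yes t≤b = ≤-trans t≤b b≤q
    ... | no t≰b  = proj₁ q-join t (∈-select⁺ X? (inj₁ (t∈T , t≰b)))

    g-props = bounded⇒join T T≤q
    g = proj₁ g-props
    g-join = proj₂ g-props
    g≤q = proj₂ g-join q T≤q

    q≢0̂ : q ≢ 0̂
    q≢0̂ q≡0̂ = b≢0̂ (≤0̂⇒≡0̂ (≡.subst (b ≤_) q≡0̂ b≤q))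

    module Q = BuildingSet G₂ G₂-building q q≢0̂

    -- g and b lie below the same G₂-factor of q (else f, below both, is 0̂), and that factor bounds X, so it is q
    same-factor⇒q∈G₂ : ∀ {m m′} → Q.Factor m → Q.Factor m′ → g ≤ m → b ≤ m′ → Dec (m ≡ m′) → q ∈ G₂
    same-factor⇒q∈G₂ {m} m-fac _ g≤m b≤m (yes ≡.refl) =
      ≡.subst (_∈ G₂) (≤-antisym (maxBelow-≤ m-fac) (proj₂ q-join m X≤m)) (maxBelow-∈ m-fac)
      where
      X≤m : UpperBound X m
      X≤m x x∈X with ∈-select⁻ X? x∈X
      ... | inj₁ (x∈T , _) = ≤-trans (proj₁ g-join x x∈T) g≤m
      ... | inj₂ ≡.refl    = b≤m
    same-factor⇒q∈G₂ m-fac m′-fac g≤m b≤m′ (no m≢m′) = ⊥-elim (0̂∉G₁ (≡.subst (_∈ G₁) f≡0̂ (maxBelow-∈ f-fac)))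
      where
      f≡0̂ = Q.below-two-factors⇒0̂ m-fac m′-fac m≢m′
              (≤-trans (proj₁ g-join f f∈T) g≤m) (≤-trans (maxBelow-≤ f-fac) b≤m′)

    g∉G₁ : g ∉ G₁
    g∉G₁ g∈G₁ with below-maximal G₂ q (G₁⊆G₂ g∈G₁) g≤q | below-maximal G₂ q b∈G₂ b≤q
    ... | m , m-fac , g≤m | m′ , m′-fac , b≤m′ = q∉G₂ (same-factor⇒q∈G₂ m-fac m′-fac g≤m b≤m′ (m ≟ᶠ m′))

    join∉G₁ : ∃ λ j → IsJoin L T j × j ∉ G₁
    join∉G₁ = g , g-join , g∉G₁

  nested₂-∪b⇒nested₁-∪F : ∀ {S} → b ∉ S → IsNested L G₂ (S ∪ ⁅ b ⁆) → IsNested L G₁ (S ∪ F)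
  nested₂-∪b⇒nested₁-∪F {S} b∉S S∪b-nested@(S∪b⊆G₂ , joins₂) = S∪F⊆G₁ , joins₁
    where
    S⊆S∪b : S ⊆ S ∪ ⁅ b ⁆
    S⊆S∪b x∈S = x∈p∪q⁺ (inj₁ x∈S)

    S∪F⊆G₁ : S ∪ F ⊆ G₁
    S∪F⊆G₁ x∈S∪F with x∈p∪q⁻ S F x∈S∪F
    ... | inj₁ x∈S = ⊆G₂×∌b⇒⊆G₁ (λ y∈S → S∪b⊆G₂ (S⊆S∪b y∈S)) b∉S x∈S
    ... | inj₂ x∈F = F⊆G₁ x∈F

    meeting-F : ∀ {T f} → T ⊆ S ∪ F → 2 ℕ.≤ ∣ T ∣ → PairwiseIncomparable L T → f ∈ T → f ∈ F →
                ∃ λ j → IsJoin L T j × j ∉ G₁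
    meeting-F {T} T⊆S∪F 2≤∣T∣ antichain f∈T f∈F with any? (λ t → (t ∈? T) ×-dec ¬? (t ≤? b))
    ... | yes (a , a∈T , a≰b) = ReplaceBelowByB.join∉G₁ S∪b-nested T⊆S∪F antichain f∈T (∈factors⁻ f∈F) a∈T a≰b
    ... | no ¬a = join∉G₁-below-b antichain 2≤∣T∣ f∈T (∈factors⁻ f∈F)
                    λ t t∈T → decidable-stable (t ≤? b) (λ t≰b → ¬a (t , t∈T , t≰b))

    joins₁ : ∀ T → T ⊆ S ∪ F → 2 ℕ.≤ ∣ T ∣ → PairwiseIncomparable L T → ∃ λ j → IsJoin L T j × j ∉ G₁
    joins₁ T T⊆S∪F 2≤∣T∣ antichain with any? (λ x → (x ∈? T) ×-dec ¬? (x ∈? S))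
    ... | no ¬x = join∉G₂⇒join∉G₁ (joins₂ T T⊆S∪b 2≤∣T∣ antichain)
      where
      T⊆S∪b : T ⊆ S ∪ ⁅ b ⁆
      T⊆S∪b {x} x∈T = S⊆S∪b (decidable-stable (x ∈? S) (λ x∉S → ¬x (x , x∈T , x∉S)))
    ... | yes (f , f∈T , f∉S) with x∈p∪q⁻ S F (T⊆S∪F f∈T)
    ...   | inj₁ f∈S = ⊥-elim (f∉S f∈S)
    ...   | inj₂ f∈F = meeting-F T⊆S∪F 2≤∣T∣ antichain f∈T f∈F

  module ReplaceBByFactors {S T} (S∪F-nested₁ : IsNested L G₁ (S ∪ F)) (T⊆S∪b : T ⊆ S ∪ ⁅ b ⁆) (2≤∣T∣ : 2 ℕ.≤ ∣ T ∣)
                           (antichain : PairwiseIncomparable L T) (b∈T : b ∈ T) where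

    other : ∃ λ t → t ∈ T × t ≢ b
    other = 2≤∣p∣⇒∃≢ b 2≤∣T∣

    t = proj₁ other
    t∈T = proj₁ (proj₂ other)
    t≢b = proj₂ (proj₂ other)

    t≰b : ¬ t ≤ b
    t≰b = antichain t b t∈T b∈T t≢b
    b≰t : ¬ b ≤ t
    b≰t = antichain b t b∈T t∈T (λ b≡t → t≢b (≡.sym b≡t))

    Y? : ∀ x → Dec ((x ∈ T × x ≢ b) ⊎ (Factor x × (∀ t′ → t′ ∈ T → t′ ≢ b → ¬ x ≤ t′)))
    Y? x = ((x ∈? T) ×-dec ¬? (x ≟ᶠ b)) ⊎-dec
           (maxBelow? L G₁ b x ×-dec all? (λ t′ → (t′ ∈? T) →-dec (¬? (t′ ≟ᶠ b) →-dec ¬? (x ≤? t′))))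
    Y = select Y?

    Y⊆S∪F : Y ⊆ S ∪ F
    Y⊆S∪F y∈Y with ∈-select⁻ Y? y∈Y
    ... | inj₂ (y-fac , _)    = x∈p∪q⁺ (inj₂ (∈factors⁺ y-fac))
    ... | inj₁ (y∈T , y≢b) with x∈p∪q⁻ S ⁅ b ⁆ (T⊆S∪b y∈T)
    ...   | inj₁ y∈S  = x∈p∪q⁺ (inj₁ y∈S)
    ...   | inj₂ y∈⁅b⁆ = ⊥-elim (y≢b (x∈⁅y⁆⇒x≡y b y∈⁅b⁆))

    Y-antichain : PairwiseIncomparable L Y
    Y-antichain x y x∈Y y∈Y x≢y x≤y with ∈-select⁻ Y? x∈Y | ∈-select⁻ Y? y∈Y
    ... | inj₁ (x∈T , _)   | inj₁ (y∈T , _)   = antichain x y x∈T y∈T x≢y x≤y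
    ... | inj₁ (x∈T , x≢b) | inj₂ (y-fac , _) = antichain x b x∈T b∈T x≢b (≤-trans x≤y (maxBelow-≤ y-fac))
    ... | inj₂ (_ , x≰T)   | inj₁ (y∈T , y≢b) = x≰T y y∈T y≢b x≤y
    ... | inj₂ (x-fac , _) | inj₂ (y-fac , _) = factors-antichain x y (∈factors⁺ x-fac) (∈factors⁺ y-fac) x≢y x≤y

    2≤∣Y∣ : 2 ℕ.≤ ∣ Y ∣
    2≤∣Y∣ with any? (λ t′ → (t′ ∈? T) ×-dec (¬? (t′ ≟ᶠ b) ×-dec ¬? (t′ ≟ᶠ t)))
    ... | yes (t′ , t′∈T , t′≢b , t′≢t) =
      ∈×∈⇒2≤∣p∣ (∈-select⁺ Y? (inj₁ (t′∈T , t′≢b))) (∈-select⁺ Y? (inj₁ (t∈T , t≢b))) t′≢t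
    ... | no ¬t′ with any? (λ f → maxBelow? L G₁ b f ×-dec ¬? (f ≤? t))
    ...   | yes (f , f-fac , f≰t) = ∈×∈⇒2≤∣p∣ (∈-select⁺ Y? (inj₂ (f-fac , f≰T))) (∈-select⁺ Y? (inj₁ (t∈T , t≢b)))
                                      (λ f≡t → t≰b (≡.subst (_≤ b) f≡t (maxBelow-≤ f-fac)))
      where
      f≰T : ∀ t′ → t′ ∈ T → t′ ≢ b → ¬ f ≤ t′
      f≰T t′ t′∈T t′≢b = ≡.subst (λ u → ¬ f ≤ u)
        (≡.sym (decidable-stable (t′ ≟ᶠ t) (λ t′≢t → ¬t′ (t′ , t′∈T , t′≢b , t′≢t)))) f≰t
    ...   | no ¬f = ⊥-elim (b≰t (proj₂ factors-join t λ f f∈F →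
                      decidable-stable (f ≤? t) (λ f≰t → ¬f (f , ∈factors⁻ f∈F , f≰t))))

    UpperBound-Y⇒T : ∀ u → UpperBound Y u → UpperBound T u
    UpperBound-Y⇒T u Y≤u x x∈T with x ≟ᶠ b
    ... | no x≢b      = Y≤u x (∈-select⁺ Y? (inj₁ (x∈T , x≢b)))
    ... | yes ≡.refl = proj₂ factors-join u F≤u
      where
      F≤u : UpperBound F u
      F≤u f f∈F with any? (λ t′ → (t′ ∈? T) ×-dec (¬? (t′ ≟ᶠ b) ×-dec (f ≤? t′)))
      ... | yes (t′ , t′∈T , t′≢b , f≤t′) = ≤-trans f≤t′ (Y≤u t′ (∈-select⁺ Y? (inj₁ (t′∈T , t′≢b))))
      ... | no ¬t′ = Y≤u f (∈-select⁺ Y? (inj₂ (∈factors⁻ f∈F ,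
                       λ t′ t′∈T t′≢b f≤t′ → ¬t′ (t′ , t′∈T , t′≢b , f≤t′))))

    UpperBound-T⇒Y : ∀ u → UpperBound T u → UpperBound Y u
    UpperBound-T⇒Y u T≤u y y∈Y with ∈-select⁻ Y? y∈Y
    ... | inj₁ (y∈T , _)   = T≤u y y∈T
    ... | inj₂ (y-fac , _) = ≤-trans (maxBelow-≤ y-fac) (T≤u b b∈T)

    j-props = proj₂ S∪F-nested₁ Y Y⊆S∪F 2≤∣Y∣ Y-antichain
    j = proj₁ j-props
    j∉G₁ = proj₂ (proj₂ j-props)

    j-join : IsJoin L T j
    j-join = UpperBound-Y⇒T j (proj₁ (proj₁ (proj₂ j-props)))
           , λ u T≤u → proj₂ (proj₁ (proj₂ j-props)) u (UpperBound-T⇒Y u T≤u)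

    join∉G₂ : ∃ λ j → IsJoin L T j × j ∉ G₂
    join∉G₂ = j , j-join , ∉G₁×≢b⇒∉G₂ j∉G₁ (λ j≡b → t≰b (≡.subst (t ≤_) j≡b (proj₁ j-join t t∈T)))

  nested₁-∪F⇒nested₂-∪b : ∀ {S} → IsNested L G₁ (S ∪ F) → ¬ (F ⊆ S) → IsNested L G₂ (S ∪ ⁅ b ⁆)
  nested₁-∪F⇒nested₂-∪b {S} S∪F-nested F⊈S = S∪b⊆G₂ , joins₂
    where
    S⊆S∪F : S ⊆ S ∪ F
    S⊆S∪F x∈S = x∈p∪q⁺ (inj₁ x∈S)

    S∪b⊆G₂ : S ∪ ⁅ b ⁆ ⊆ G₂
    S∪b⊆G₂ x∈S∪b with x∈p∪q⁻ S ⁅ b ⁆ x∈S∪b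
    ... | inj₁ x∈S   = G₁⊆G₂ (proj₁ S∪F-nested (S⊆S∪F x∈S))
    ... | inj₂ x∈⁅b⁆ = ≡.subst (_∈ G₂) (≡.sym (x∈⁅y⁆⇒x≡y b x∈⁅b⁆)) b∈G₂

    joins₂ : ∀ T → T ⊆ S ∪ ⁅ b ⁆ → 2 ℕ.≤ ∣ T ∣ → PairwiseIncomparable L T → ∃ λ j → IsJoin L T j × j ∉ G₂
    joins₂ T T⊆S∪b 2≤∣T∣ antichain with b ∈? T
    ... | yes b∈T = ReplaceBByFactors.join∉G₂ S∪F-nested T⊆S∪b 2≤∣T∣ antichain b∈T
    ... | no b∉T = proj₂ (nested₁⇒nested₂ (nested-⊆ S∪F-nested S⊆S∪F) F⊈S) T T⊆S 2≤∣T∣ antichain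
      where
      T⊆S : T ⊆ S
      T⊆S x∈T with x∈p∪q⁻ S ⁅ b ⁆ (T⊆S∪b x∈T)
      ... | inj₁ x∈S   = x∈S
      ... | inj₂ x∈⁅b⁆ = ⊥-elim (b∉T (≡.subst (_∈ T) (x∈⁅y⁆⇒x≡y b x∈⁅b⁆) x∈T))

  nested₂⇔nested₁ : ∀ {S} → b ∉ S → IsNested L G₂ S ⇔ (IsNested L G₁ S × ¬ (F ⊆ S))
  nested₂⇔nested₁ b∉S = mk⇔ (λ S-nested₂ → nested₂⇒nested₁ b∉S S-nested₂ , nested₂-F⊈ S-nested₂)
                             (λ (S-nested₁ , F⊈S) → nested₁⇒nested₂ S-nested₁ F⊈S)

  nested₂-∪b⇔nested₁-∪F : ∀ {S} → b ∉ S → IsNested L G₂ (S ∪ ⁅ b ⁆) ⇔ (IsNested L G₁ (S ∪ F) × ¬ (F ⊆ S))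
  nested₂-∪b⇔nested₁-∪F b∉S =
    mk⇔ (λ S∪b-nested₂ → nested₂-∪b⇒nested₁-∪F b∉S S∪b-nested₂
                        , λ F⊆S → nested₂-F⊈ S∪b-nested₂ (λ f∈F → x∈p∪q⁺ (inj₁ (F⊆S f∈F))))
        (λ (S∪F-nested₁ , F⊈S) → nested₁-∪F⇒nested₂-∪b S∪F-nested₁ F⊈S)

module SubsetSums {c ℓ : Level} (R : CommutativeRing c ℓ) where

  open CommutativeRing R hiding (zero) renaming (Carrier to A)
  open import Algebra.Properties.Ring ring using (-0#≈0#; -‿+-comm; -‿distribˡ-*)
  open import Algebra.Properties.CommutativeSemigroup +-commutativeSemigroup using () renaming (interchange to +-interchange)
  open import Algebra.Properties.CommutativeSemigroup *-commutativeSemigroup using (x∙yz≈y∙xz)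
  open import Data.Fin.Subset.Properties using (drop-∷-⊆; ∪-identityʳ; p⊆q⇒∣p∣≤∣q∣)
  open import Data.List as List using (List; []; _∷_; _++_; map; filter; foldr; allFin)
  open import Data.List.Properties using (map-++; map-∘; map-tabulate)
  open Relation.Binary.Reasoning.Setoid setoid
  open Comprehension using (select)

  when : Bool → A → A
  when β x = if β then x else 0#

  unless : Bool → A → A
  unless β x = if β then 0# else x

  when-cong : ∀ β {x y} → x ≈ y → when β x ≈ when β y
  when-cong true  x≈y = x≈y
  when-cong false _   = refl

  when-0 : ∀ β → when β 0# ≈ 0#
  when-0 true  = refl
  when-0 false = refl

  unless-0 : ∀ β → unless β 0# ≈ 0#
  unless-0 true  = refl
  unless-0 false = refl

  when-+ : ∀ β x y → when β (x + y) ≈ when β x + when β y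
  when-+ true  x y = refl
  when-+ false x y = sym (+-identityʳ 0#)

  when-*ˡ : ∀ β x y → when β (x * y) ≈ x * when β y
  when-*ˡ true  x y = refl
  when-*ˡ false x y = sym (zeroʳ x)

  when-*ʳ : ∀ β x y → when β x * y ≈ when β (x * y)
  when-*ʳ true  x y = refl
  when-*ʳ false x y = zeroˡ y

  when-neg : ∀ β x → when β (- x) ≈ - when β x
  when-neg true  x = refl
  when-neg false x = sym -0#≈0#

  unless+when : ∀ β x → x ≈ unless β x + when β x
  unless+when true  x = sym (+-identityˡ x)
  unless+when false x = sym (+-identityʳ x)

  ∑ : ∀ {n} → (Subset n → A) → A
  ∑ {zero}  f = f []
  ∑ {suc n} f = ∑ (λ S → f (inside ∷ S)) + ∑ (λ S → f (outside ∷ S))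

  ∑-cong : ∀ {n} {f g : Subset n → A} → (∀ S → f S ≈ g S) → ∑ f ≈ ∑ g
  ∑-cong {zero}  f≈g = f≈g []
  ∑-cong {suc n} f≈g = +-cong (∑-cong (λ S → f≈g (inside ∷ S))) (∑-cong (λ S → f≈g (outside ∷ S)))

  ∑-0 : ∀ {n} → ∑ {n} (λ _ → 0#) ≈ 0#
  ∑-0 {zero}  = refl
  ∑-0 {suc n} = trans (+-cong (∑-0 {n}) (∑-0 {n})) (+-identityʳ 0#)

  ∑-+ : ∀ {n} (f g : Subset n → A) → ∑ (λ S → f S + g S) ≈ ∑ f + ∑ g
  ∑-+ {zero}  f g = refl
  ∑-+ {suc n} f g = trans (+-cong (∑-+ (λ S → f (inside ∷ S)) (λ S → g (inside ∷ S)))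
                                  (∑-+ (λ S → f (outside ∷ S)) (λ S → g (outside ∷ S))))
                          (+-interchange _ _ _ _)

  ∑-neg : ∀ {n} (f : Subset n → A) → ∑ (λ S → - f S) ≈ - ∑ f
  ∑-neg {zero}  f = refl
  ∑-neg {suc n} f = trans (+-cong (∑-neg (λ S → f (inside ∷ S))) (∑-neg (λ S → f (outside ∷ S)))) (-‿+-comm _ _)

  ∑-*ˡ : ∀ {n} x (f : Subset n → A) → x * ∑ f ≈ ∑ (λ S → x * f S)
  ∑-*ˡ {zero}  x f = refl
  ∑-*ˡ {suc n} x f = trans (distribˡ x _ _) (+-cong (∑-*ˡ x (λ S → f (inside ∷ S))) (∑-*ˡ x (λ S → f (outside ∷ S))))

  ∑-*ʳ : ∀ {n} (f : Subset n → A) x → ∑ f * x ≈ ∑ (λ S → f S * x)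
  ∑-*ʳ f x = trans (*-comm (∑ f) x) (trans (∑-*ˡ x f) (∑-cong (λ S → *-comm x (f S))))

  ∑-swap : ∀ {n m} (f : Subset n → Subset m → A) → ∑ (λ U → ∑ (λ T → f U T)) ≈ ∑ (λ T → ∑ (λ U → f U T))
  ∑-swap {zero}  f = refl
  ∑-swap {suc n} f = trans (+-cong (∑-swap (λ U → f (inside ∷ U))) (∑-swap (λ U → f (outside ∷ U))))
                           (sym (∑-+ (λ T → ∑ (λ U → f (inside ∷ U) T)) (λ T → ∑ (λ U → f (outside ∷ U) T))))

  ∑∈ : ∀ {n} → Subset n → (Fin n → A) → A
  ∑∈ []            g = 0#
  ∑∈ (inside ∷ S)  g = g zero + ∑∈ S (λ i → g (suc i))
  ∑∈ (outside ∷ S) g = ∑∈ S (λ i → g (suc i))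

  ∏ : ∀ {n} → Subset n → (Fin n → A) → A
  ∏ []            g = 1#
  ∏ (inside ∷ S)  g = g zero * ∏ S (λ i → g (suc i))
  ∏ (outside ∷ S) g = ∏ S (λ i → g (suc i))

  sumₗ : List A → A
  sumₗ = foldr _+_ 0#

  productₗ : List A → A
  productₗ = foldr _*_ 1#

  sumₗ-++ : ∀ xs ys → sumₗ (xs ++ ys) ≈ sumₗ xs + sumₗ ys
  sumₗ-++ []       ys = sym (+-identityˡ _)
  sumₗ-++ (x ∷ xs) ys = trans (+-congˡ (sumₗ-++ xs ys)) (sym (+-assoc x _ _))

  sumₗ-filter : ∀ {a p} {X : Set a} {P : Pred X p} (P? : Decidable P) (f : X → A) xs →
                sumₗ (map f (filter P? xs)) ≈ sumₗ (map (λ x → when (does (P? x)) (f x)) xs)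
  sumₗ-filter P? f []       = refl
  sumₗ-filter P? f (x ∷ xs) with does (P? x)
  ... | true  = +-congˡ (sumₗ-filter P? f xs)
  ... | false = trans (sumₗ-filter P? f xs) (sym (+-identityˡ _))

  productₗ-filter : ∀ {a p} {X : Set a} {P : Pred X p} (P? : Decidable P) (f : X → A) xs →
                    productₗ (map f (filter P? xs)) ≈ productₗ (map (λ x → if does (P? x) then f x else 1#) xs)
  productₗ-filter P? f []       = refl
  productₗ-filter P? f (x ∷ xs) with does (P? x)
  ... | true  = *-congˡ (productₗ-filter P? f xs)
  ... | false = trans (productₗ-filter P? f xs) (sym (*-identityˡ _))

  sumₗ-allSubsets : ∀ {n} (f : Subset n → A) → sumₗ (map f (allSubsets n)) ≈ ∑ f
  sumₗ-allSubsets {zero}  f = +-identityʳ (f [])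
  sumₗ-allSubsets {suc n} f = begin
    sumₗ (map f (map (inside ∷_) (allSubsets n) ++ map (outside ∷_) (allSubsets n)))
      ≡⟨ ≡.cong sumₗ (map-++ f (map (inside ∷_) (allSubsets n)) _) ⟩
    sumₗ (map f (map (inside ∷_) (allSubsets n)) ++ map f (map (outside ∷_) (allSubsets n)))
      ≈⟨ sumₗ-++ (map f (map (inside ∷_) (allSubsets n))) _ ⟩
    sumₗ (map f (map (inside ∷_) (allSubsets n))) + sumₗ (map f (map (outside ∷_) (allSubsets n)))
      ≡⟨ ≡.cong₂ (λ xs ys → sumₗ xs + sumₗ ys) (≡.sym (map-∘ (allSubsets n))) (≡.sym (map-∘ (allSubsets n))) ⟩
    sumₗ (map (λ S → f (inside ∷ S)) (allSubsets n)) + sumₗ (map (λ S → f (outside ∷ S)) (allSubsets n))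
      ≈⟨ +-cong (sumₗ-allSubsets (λ S → f (inside ∷ S))) (sumₗ-allSubsets (λ S → f (outside ∷ S))) ⟩
    ∑ f ∎

  productₗ-∈ : ∀ {n} (S : Subset n) (g : Fin n → A) → productₗ (map g (filter (_∈? S) (allFin n))) ≈ ∏ S g
  productₗ-∈ {n} S g = begin
    productₗ (map g (filter (_∈? S) (allFin n)))
      ≈⟨ productₗ-filter (_∈? S) g (allFin n) ⟩
    productₗ (map (λ i → if does (i ∈? S) then g i else 1#) (allFin n))
      ≡⟨ ≡.cong productₗ (map-tabulate {n = n} (λ i → i) _) ⟩
    productₗ (List.tabulate (λ i → if does (i ∈? S) then g i else 1#))
      ≈⟨ tabulated S g ⟩
    ∏ S g ∎
    where
    tabulated : ∀ {n} (S : Subset n) g → productₗ (List.tabulate (λ i → if does (i ∈? S) then g i else 1#)) ≈ ∏ S g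
    tabulated []            g = refl
    tabulated (inside ∷ S)  g = *-congˡ (tabulated S (λ i → g (suc i)))
    tabulated (outside ∷ S) g = trans (*-identityˡ _) (tabulated S (λ i → g (suc i)))

  sumₗ-select : ∀ {n p} {P : Pred (Fin n) p} (P? : Decidable P) (g : Fin n → A) →
                sumₗ (map g (filter P? (allFin n))) ≈ ∑∈ (select P?) g
  sumₗ-select {n} P? g = begin
    sumₗ (map g (filter P? (allFin n)))
      ≈⟨ sumₗ-filter P? g (allFin n) ⟩
    sumₗ (map (λ i → when (does (P? i)) (g i)) (allFin n))
      ≡⟨ ≡.cong sumₗ (map-tabulate {n = n} (λ i → i) _) ⟩
    sumₗ (List.tabulate (λ i → when (does (P? i)) (g i)))
      ≈⟨ tabulated (λ i → does (P? i)) g ⟩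
    ∑∈ (select P?) g ∎
    where
    tabulated : ∀ {n} (β : Fin n → Bool) g →
                sumₗ (List.tabulate (λ i → when (β i) (g i))) ≈ ∑∈ (Data.Vec.tabulate (λ i → if β i then inside else outside)) g
    tabulated {zero}  β g = refl
    tabulated {suc n} β g with β zero
    ... | true  = +-congˡ (tabulated (λ i → β (suc i)) (λ i → g (suc i)))
    ... | false = trans (+-identityˡ _) (tabulated (λ i → β (suc i)) (λ i → g (suc i)))

  ∏-─-split : ∀ {n} (F T : Subset n) → F ⊆ T → (z : Fin n → A) → ∏ T z ≈ ∏ (T ─ F) z * ∏ F z
  ∏-─-split []            []            _   z = sym (*-identityʳ 1#)
  ∏-─-split (inside ∷ F)  (inside ∷ T)  F⊆T z =
    trans (*-congˡ (∏-─-split F T (drop-∷-⊆ F⊆T) (λ i → z (suc i)))) (x∙yz≈y∙xz _ _ _)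
  ∏-─-split (inside ∷ F)  (outside ∷ T) F⊆T z with F⊆T here
  ... | ()
  ∏-─-split (outside ∷ F) (inside ∷ T)  F⊆T z =
    trans (*-congˡ (∏-─-split F T (drop-∷-⊆ F⊆T) (λ i → z (suc i)))) (sym (*-assoc _ _ _))
  ∏-─-split (outside ∷ F) (outside ∷ T) F⊆T z = ∏-─-split F T (drop-∷-⊆ F⊆T) (λ i → z (suc i))

  ∏-∪-─-∩ : ∀ {n} (S F : Subset n) (z : Fin n → A) → ∏ ((S ∪ F) ─ F) z * ∏ (S ∩ F) z ≈ ∏ S z
  ∏-∪-─-∩ []            []            z = *-identityʳ 1#
  ∏-∪-─-∩ (inside ∷ S)  (inside ∷ F)  z = trans (x∙yz≈y∙xz _ _ _) (*-congˡ (∏-∪-─-∩ S F (λ i → z (suc i))))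
  ∏-∪-─-∩ (inside ∷ S)  (outside ∷ F) z = trans (*-assoc _ _ _) (*-congˡ (∏-∪-─-∩ S F (λ i → z (suc i))))
  ∏-∪-─-∩ (outside ∷ S) (inside ∷ F)  z = ∏-∪-─-∩ S F (λ i → z (suc i))
  ∏-∪-─-∩ (outside ∷ S) (outside ∷ F) z = ∏-∪-─-∩ S F (λ i → z (suc i))

  ∏-∪⁅⁆ : ∀ {n} (b : Fin n) (S : Subset n) → b ∉ S → (z : Fin n → A) → ∏ (S ∪ ⁅ b ⁆) z ≈ z b * ∏ S z
  ∏-∪⁅⁆ zero    (inside ∷ S)  b∉S z = ⊥-elim (b∉S here)
  ∏-∪⁅⁆ zero    (outside ∷ S) b∉S z = *-congˡ (reflexive (≡.cong (λ X → ∏ X (λ i → z (suc i))) (∪-identityʳ S)))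
  ∏-∪⁅⁆ (suc b) (inside ∷ S)  b∉S z =
    trans (*-congˡ (∏-∪⁅⁆ b S (λ b∈S → b∉S (there b∈S)) (λ i → z (suc i)))) (x∙yz≈y∙xz _ _ _)
  ∏-∪⁅⁆ (suc b) (outside ∷ S) b∉S z = ∏-∪⁅⁆ b S (λ b∈S → b∉S (there b∈S)) (λ i → z (suc i))

  ∑-∋-shift : ∀ {n} (b : Fin n) (f : Subset n → A) →
              ∑ (λ S → when (does (b ∈? S)) (f S)) ≈ ∑ (λ S → unless (does (b ∈? S)) (f (S ∪ ⁅ b ⁆)))
  ∑-∋-shift {suc n} zero f = begin
    ∑ (λ S → f (inside ∷ S)) + ∑ {n} (λ _ → 0#)   ≈⟨ +-congˡ (∑-0 {n}) ⟩
    ∑ (λ S → f (inside ∷ S)) + 0#                 ≈⟨ +-comm _ _ ⟩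
    0# + ∑ (λ S → f (inside ∷ S))                 ≈⟨ +-cong (sym (∑-0 {n})) (∑-cong (λ S →
                                                       reflexive (≡.cong (λ X → f (inside ∷ X)) (≡.sym (∪-identityʳ S))))) ⟩
    ∑ {n} (λ _ → 0#) + ∑ (λ S → f (inside ∷ (S ∪ Sub.⊥))) ∎
  ∑-∋-shift {suc n} (suc b) f = +-cong (∑-∋-shift b (λ S → f (inside ∷ S))) (∑-∋-shift b (λ S → f (outside ∷ S)))

  ∑⊆ : ∀ {n} → Subset n → (Subset n → A) → A
  ∑⊆ F f = ∑ (λ C → when (does (C ⊆? F)) (f C))

  ∑⊆-cong : ∀ {n} (F : Subset n) {f g : Subset n → A} → (∀ C → f C ≈ g C) → ∑⊆ F f ≈ ∑⊆ F g
  ∑⊆-cong F f≈g = ∑-cong (λ C → when-cong (does (C ⊆? F)) (f≈g C))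

  ∑⊆-+ : ∀ {n} (F : Subset n) (f g : Subset n → A) → ∑⊆ F (λ C → f C + g C) ≈ ∑⊆ F f + ∑⊆ F g
  ∑⊆-+ F f g = trans (∑-cong (λ C → when-+ (does (C ⊆? F)) (f C) (g C)))
    (∑-+ (λ C → when (does (C ⊆? F)) (f C)) (λ C → when (does (C ⊆? F)) (g C)))

  ∑⊆-*ˡ : ∀ {n} (F : Subset n) x (f : Subset n → A) → x * ∑⊆ F f ≈ ∑⊆ F (λ C → x * f C)
  ∑⊆-*ˡ F x f = trans (∑-*ˡ x (λ C → when (does (C ⊆? F)) (f C))) (∑-cong (λ C → sym (when-*ˡ (does (C ⊆? F)) x (f C))))

  ∑⊆-neg : ∀ {n} (F : Subset n) (f : Subset n → A) → ∑⊆ F (λ C → - f C) ≈ - ∑⊆ F f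
  ∑⊆-neg F f = trans (∑-cong (λ C → when-neg (does (C ⊆? F)) (f C))) (∑-neg (λ C → when (does (C ⊆? F)) (f C)))

  ∑⊆-outside : ∀ {n} (F : Subset n) (f : Subset (suc n) → A) → ∑⊆ (outside ∷ F) f ≈ ∑⊆ F (λ C → f (outside ∷ C))
  ∑⊆-outside {n} F f = trans (+-congʳ (∑-0 {n})) (+-identityˡ _)

  ∑⊆≈∑⊊+whole : ∀ {n} (F : Subset n) (f : Subset n → A) → ∑⊆ F f ≈ ∑⊆ F (λ C → unless (does (F ⊆? C)) (f C)) + f F
  ∑⊆≈∑⊊+whole []            f = sym (+-identityˡ _)
  ∑⊆≈∑⊊+whole (inside ∷ F)  f = begin
    ∑⊆ F (λ C → f (inside ∷ C)) + rest                 ≈⟨ +-congʳ (∑⊆≈∑⊊+whole F (λ C → f (inside ∷ C))) ⟩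
    (proper + f (inside ∷ F)) + rest                    ≈⟨ +-assoc _ _ _ ⟩
    proper + (f (inside ∷ F) + rest)                    ≈⟨ +-congˡ (+-comm _ _) ⟩
    proper + (rest + f (inside ∷ F))                    ≈⟨ +-assoc _ _ _ ⟨
    (proper + rest) + f (inside ∷ F)                    ∎
    where
    proper = ∑⊆ F (λ C → unless (does (F ⊆? C)) (f (inside ∷ C)))
    rest   = ∑⊆ F (λ C → f (outside ∷ C))
  ∑⊆≈∑⊊+whole (outside ∷ F) f = trans (+-congˡ (∑⊆≈∑⊊+whole F (λ C → f (outside ∷ C)))) (sym (+-assoc _ _ _))

  ∑⊇∑⊆-reindex : ∀ {n} (F : Subset n) (K : Subset n → Subset n → A) →
                 ∑ (λ T → when (does (F ⊆? T)) (∑⊆ F (K T))) ≈ ∑ (λ S → K (S ∪ F) (S ∩ F))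
  ∑⊇∑⊆-reindex []            K = refl
  ∑⊇∑⊆-reindex {suc n} (inside ∷ F) K = begin
    ∑ (λ T → when (does (F ⊆? T)) (∑⊆ F (Kᵢᵢ T) + ∑⊆ F (Kᵢₒ T))) + ∑ {n} (λ _ → 0#)
      ≈⟨ trans (+-congˡ (∑-0 {n})) (+-identityʳ _) ⟩
    ∑ (λ T → when (does (F ⊆? T)) (∑⊆ F (Kᵢᵢ T) + ∑⊆ F (Kᵢₒ T)))
      ≈⟨ trans (∑-cong (λ T → when-+ (does (F ⊆? T)) _ _))
               (∑-+ (λ T → when (does (F ⊆? T)) (∑⊆ F (Kᵢᵢ T))) (λ T → when (does (F ⊆? T)) (∑⊆ F (Kᵢₒ T)))) ⟩
    ∑ (λ T → when (does (F ⊆? T)) (∑⊆ F (Kᵢᵢ T))) + ∑ (λ T → when (does (F ⊆? T)) (∑⊆ F (Kᵢₒ T)))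
      ≈⟨ +-cong (∑⊇∑⊆-reindex F Kᵢᵢ) (∑⊇∑⊆-reindex F Kᵢₒ) ⟩
    ∑ (λ S → K (inside ∷ (S ∪ F)) (inside ∷ (S ∩ F))) + ∑ (λ S → K (inside ∷ (S ∪ F)) (outside ∷ (S ∩ F))) ∎
    where
    Kᵢᵢ Kᵢₒ : Subset n → Subset n → A
    Kᵢᵢ T C = K (inside ∷ T) (inside ∷ C)
    Kᵢₒ T C = K (inside ∷ T) (outside ∷ C)
  ∑⊇∑⊆-reindex (outside ∷ F) K =
    +-cong (trans (∑-cong (λ T → when-cong (does (F ⊆? T)) (∑⊆-outside F (K (inside ∷ T)))))
                  (∑⊇∑⊆-reindex F (λ T C → K (inside ∷ T) (outside ∷ C))))
           (trans (∑-cong (λ T → when-cong (does (F ⊆? T)) (∑⊆-outside F (K (outside ∷ T)))))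
                  (∑⊇∑⊆-reindex F (λ T C → K (outside ∷ T) (outside ∷ C))))

  open IntegerCast R using (fromℤ; fromℤ-suc; fromℤ-neg; solve; _:+_; _:*_; :-_; _:=_; con)

  ∑⊆∏≈∏1+ : ∀ {n} (F : Subset n) (z : Fin n → A) → ∑⊆ F (λ C → ∏ C z) ≈ ∏ F (λ i → 1# + z i)
  ∑⊆∏≈∏1+ []            z = refl
  ∑⊆∏≈∏1+ (inside ∷ F)  z = begin
    ∑⊆ F (λ C → z zero * ∏ C z′) + ∑⊆ F (λ C → ∏ C z′)  ≈⟨ +-congʳ (∑⊆-*ˡ F (z zero) (λ C → ∏ C z′)) ⟨
    z zero * ∑⊆ F (λ C → ∏ C z′) + ∑⊆ F (λ C → ∏ C z′) ≈⟨ +-cong (*-congˡ IH) IH ⟩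
    z zero * P + P                                       ≈⟨ solve 2 (λ z₀ P → z₀ :* P :+ P := (con (+ 1) :+ z₀) :* P) refl (z zero) P ⟩
    (1# + z zero) * P                                    ∎
    where
    z′ = λ i → z (suc i)
    P = ∏ F (λ i → 1# + z′ i)
    IH = ∑⊆∏≈∏1+ F z′
  ∑⊆∏≈∏1+ (outside ∷ F) z = trans (∑⊆-outside F (λ C → ∏ C z)) (∑⊆∏≈∏1+ F (λ i → z (suc i)))

  ∑⊆∣─∣∏≈∑∈*∏1+ : ∀ {n} (F : Subset n) (z α : Fin n → A) → (∀ i → i ∈ F → α i * (1# + z i) ≈ 1#) →
                  ∑⊆ F (λ C → fromℤ (+ ∣ F ─ C ∣) * ∏ C z) ≈ ∑∈ F α * ∏ F (λ i → 1# + z i)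
  ∑⊆∣─∣∏≈∑∈*∏1+ []            z α inverse = refl
  ∑⊆∣─∣∏≈∑∈*∏1+ (outside ∷ F) z α inverse =
    trans (∑⊆-outside F (λ C → fromℤ (+ ∣ (outside ∷ F) ─ C ∣) * ∏ C z))
          (∑⊆∣─∣∏≈∑∈*∏1+ F (λ i → z (suc i)) (λ i → α (suc i)) (λ i i∈F → inverse (suc i) (there i∈F)))
  ∑⊆∣─∣∏≈∑∈*∏1+ (inside ∷ F)  z α inverse = begin
    ∑⊆ F (λ C → k C * (z zero * ∏ C z′)) + ∑⊆ F (λ C → fromℤ (+ suc ∣ F ─ C ∣) * ∏ C z′)
      ≈⟨ +-cong (trans (∑⊆-cong F (λ C → x∙yz≈y∙xz _ _ _)) (sym (∑⊆-*ˡ F (z zero) W-term)))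
                (trans (∑⊆-cong F (λ C → trans (*-congʳ (fromℤ-suc ∣ F ─ C ∣)) (distribʳ _ _ _)))
                       (trans (∑⊆-+ F (λ C → 1# * ∏ C z′) W-term) (+-congʳ (∑⊆-cong F (λ C → *-identityˡ _))))) ⟩
    z zero * ∑⊆ F W-term + (∑⊆ F (λ C → ∏ C z′) + ∑⊆ F W-term)
      ≈⟨ +-cong (*-congˡ IH) (+-cong (∑⊆∏≈∏1+ F z′) IH) ⟩
    z zero * (S * P) + (P + S * P)
      ≈⟨ +-congˡ (+-congʳ (trans (sym (*-identityˡ P)) (*-congʳ (sym (inverse zero here))))) ⟩
    z zero * (S * P) + (α zero * (1# + z zero) * P + S * P)
      ≈⟨ solve 4 (λ z₀ S P α₀ → z₀ :* (S :* P) :+ (α₀ :* (con (+ 1) :+ z₀) :* P :+ S :* P)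
                               := (α₀ :+ S) :* ((con (+ 1) :+ z₀) :* P)) refl (z zero) S P (α zero) ⟩
    (α zero + S) * ((1# + z zero) * P) ∎
    where
    z′ = λ i → z (suc i)
    α′ = λ i → α (suc i)
    k = λ C → fromℤ (+ ∣ F ─ C ∣)
    W-term = λ C → k C * ∏ C z′
    S = ∑∈ F α′
    P = ∏ F (λ i → 1# + z′ i)
    IH = ∑⊆∣─∣∏≈∑∈*∏1+ F z′ α′ (λ i i∈F → inverse (suc i) (there i∈F))

  ∑⊆sign∏≈∏-1 : ∀ {n} (T : Subset n) (y : Fin n → A) →
                ∑⊆ T (λ U → fromℤ (signℤ (∣ T ∣ ℕ.∸ ∣ U ∣)) * ∏ U y) ≈ ∏ T (λ i → y i - 1#)
  ∑⊆sign∏≈∏-1 []            y = *-identityʳ 1#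
  ∑⊆sign∏≈∏-1 (outside ∷ T) y =
    trans (∑⊆-outside T (λ U → fromℤ (signℤ (∣ outside ∷ T ∣ ℕ.∸ ∣ U ∣)) * ∏ U y)) (∑⊆sign∏≈∏-1 T (λ i → y (suc i)))
  ∑⊆sign∏≈∏-1 (inside ∷ T)  y = begin
    ∑⊆ T (λ U → sign U * (y zero * ∏ U y′)) + ∑⊆ T (λ U → fromℤ (signℤ (suc ∣ T ∣ ℕ.∸ ∣ U ∣)) * ∏ U y′)
      ≈⟨ +-cong (trans (∑⊆-cong T (λ U → x∙yz≈y∙xz _ _ _)) (sym (∑⊆-*ˡ T (y zero) term)))
                (trans (∑-cong flip-sign) (∑⊆-neg T term)) ⟩
    y zero * ∑⊆ T term + - ∑⊆ T term   ≈⟨ +-cong (*-congˡ IH) (-‿cong IH) ⟩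
    y zero * P + - P                   ≈⟨ solve 2 (λ y₀ P → y₀ :* P :+ :- P := (y₀ :+ :- con (+ 1)) :* P) refl (y zero) P ⟩
    (y zero - 1#) * P                  ∎
    where
    y′ = λ i → y (suc i)
    sign = λ U → fromℤ (signℤ (∣ T ∣ ℕ.∸ ∣ U ∣))
    term = λ U → sign U * ∏ U y′
    P = ∏ T (λ i → y′ i - 1#)
    IH = ∑⊆sign∏≈∏-1 T y′
    flip-sign : ∀ U → when (does (U ⊆? T)) (fromℤ (signℤ (suc ∣ T ∣ ℕ.∸ ∣ U ∣)) * ∏ U y′) ≈ when (does (U ⊆? T)) (- term U)
    flip-sign U with U ⊆? T
    ... | no _    = refl
    ... | yes U⊆T rewrite ℕ.+-∸-assoc 1 (p⊆q⇒∣p∣≤∣q∣ U⊆T) =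
      trans (*-congʳ (fromℤ-neg (signℤ (∣ T ∣ ℕ.∸ ∣ U ∣)))) (sym (-‿distribˡ-* _ _))

module NestedSum {c ℓ : Level} {n : ℕ} (L : FinMeetSemilattice n) (R : CommutativeRing c ℓ) where

  open CommutativeRing R hiding (zero) renaming (Carrier to A)
  open IntegerCast R using (fromℤ; fromℤ-+; fromℤ-*)
  open SubsetSums R
  open Order L using (nested-⊆)
  open import Algebra.Properties.CommutativeSemigroup *-commutativeSemigroup using (x∙yz≈y∙xz)
  open import Algebra.Properties.Monoid.Mult.TCOptimised +-monoid using (×ᵤ≈×)
  open import Data.List using ([]; _∷_; map; filter; allFin)
  open Relation.Binary.Reasoning.Setoid setoid

  ℤ→R≈fromℤ : ∀ i → ℤ→R L R i ≈ fromℤ i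
  ℤ→R≈fromℤ (+ k)    = ×ᵤ≈× k 1#
  ℤ→R≈fromℤ -[1+ k ] = -‿cong (×ᵤ≈× (suc k) 1#)

  fromℤ-sumℤ : ∀ {X : Set} (f : X → ℤ) xs → fromℤ (sumℤ (map f xs)) ≈ sumₗ (map (λ x → fromℤ (f x)) xs)
  fromℤ-sumℤ f []       = refl
  fromℤ-sumℤ f (x ∷ xs) = trans (fromℤ-+ (f x) (sumℤ (map f xs))) (+-congˡ (fromℤ-sumℤ f xs))

  module _ (G : Subset n) (χ : Subset n → ℤ) where

    private
      nested : Subset n → Bool
      nested S = does (nested? L G S)

      sign : Subset n → Subset n → A
      sign U T = fromℤ (signℤ (∣ T ∣ ℕ.∸ ∣ U ∣))

    χ°-as-∑ : ∀ U → fromℤ (χ° L G χ U) ≈ ∑ (λ T → when (nested T) (when (does (U ⊆? T)) (sign U T * fromℤ (χ T))))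
    χ°-as-∑ U = begin
      fromℤ (χ° L G χ U)
        ≈⟨ fromℤ-sumℤ term (filter (U ⊆?_) (nestedList L G)) ⟩
      sumₗ (map (λ T → fromℤ (term T)) (filter (U ⊆?_) (filter (nested? L G) (allSubsets n))))
        ≈⟨ sumₗ-filter (U ⊆?_) (λ T → fromℤ (term T)) (filter (nested? L G) (allSubsets n)) ⟩
      sumₗ (map (λ T → when (does (U ⊆? T)) (fromℤ (term T))) (filter (nested? L G) (allSubsets n)))
        ≈⟨ sumₗ-filter (nested? L G) (λ T → when (does (U ⊆? T)) (fromℤ (term T))) (allSubsets n) ⟩
      sumₗ (map (λ T → when (nested T) (when (does (U ⊆? T)) (fromℤ (term T)))) (allSubsets n))
        ≈⟨ sumₗ-allSubsets (λ T → when (nested T) (when (does (U ⊆? T)) (fromℤ (term T)))) ⟩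
      ∑ (λ T → when (nested T) (when (does (U ⊆? T)) (fromℤ (term T))))
        ≈⟨ ∑-cong (λ T → when-cong (nested T) (when-cong (does (U ⊆? T)) (fromℤ-* (signℤ (∣ T ∣ ℕ.∸ ∣ U ∣)) (χ T)))) ⟩
      ∑ (λ T → when (nested T) (when (does (U ⊆? T)) (sign U T * fromℤ (χ T)))) ∎
      where
      term : Subset n → ℤ
      term T = signℤ (∣ T ∣ ℕ.∸ ∣ U ∣) ℤ.* χ T

    module _ (y : Fin n → A) where

      private
        summand : Subset n → Subset n → A
        summand U T = when (nested T) (when (does (U ⊆? T)) (sign U T * (fromℤ (χ T) * ∏ U y)))

        by-U : ∀ U (d : Dec (IsNested L G U)) → when (does d) (fromℤ (χ° L G χ U) * ∏ U y) ≈ ∑ (summand U)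
        by-U U (yes _) = begin
          fromℤ (χ° L G χ U) * ∏ U y
            ≈⟨ *-congʳ (χ°-as-∑ U) ⟩
          ∑ (λ T → when (nested T) (when (does (U ⊆? T)) (sign U T * fromℤ (χ T)))) * ∏ U y
            ≈⟨ ∑-*ʳ (λ T → when (nested T) (when (does (U ⊆? T)) (sign U T * fromℤ (χ T)))) (∏ U y) ⟩
          ∑ (λ T → when (nested T) (when (does (U ⊆? T)) (sign U T * fromℤ (χ T))) * ∏ U y)
            ≈⟨ ∑-cong (λ T → trans (when-*ʳ (nested T) _ _) (when-cong (nested T)
                 (trans (when-*ʳ (does (U ⊆? T)) _ _) (when-cong (does (U ⊆? T)) (*-assoc _ _ _))))) ⟩
          ∑ (summand U) ∎
        by-U U (no U-not-nested) = sym (trans (∑-cong vanishes) (∑-0 {n}))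
          where
          vanishes : ∀ T → summand U T ≈ 0#
          vanishes T = vanishes′ (nested? L G T) (U ⊆? T)
            where
            vanishes′ : (d : Dec (IsNested L G T)) (e : Dec (U ⊆ T)) →
                        when (does d) (when (does e) (sign U T * (fromℤ (χ T) * ∏ U y))) ≈ 0#
            vanishes′ (yes T-nested) (yes U⊆T) = ⊥-elim (U-not-nested (nested-⊆ T-nested U⊆T))
            vanishes′ (yes _)        (no _)    = refl
            vanishes′ (no _)         _         = refl

        by-T : ∀ T → ∑ (λ U → summand U T) ≈ when (nested T) (fromℤ (χ T) * ∏ T (λ i → y i - 1#))
        by-T T = by-T′ (nested? L G T)
          where
          by-T′ : (d : Dec (IsNested L G T)) →
                  ∑ (λ U → when (does d) (when (does (U ⊆? T)) (sign U T * (fromℤ (χ T) * ∏ U y))))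
                  ≈ when (does d) (fromℤ (χ T) * ∏ T (λ i → y i - 1#))
          by-T′ (no _)  = ∑-0 {n}
          by-T′ (yes _) = begin
            ∑⊆ T (λ U → sign U T * (fromℤ (χ T) * ∏ U y))   ≈⟨ ∑⊆-cong T (λ U → x∙yz≈y∙xz _ _ _) ⟩
            ∑⊆ T (λ U → fromℤ (χ T) * (sign U T * ∏ U y))   ≈⟨ ∑⊆-*ˡ T (fromℤ (χ T)) (λ U → sign U T * ∏ U y) ⟨
            fromℤ (χ T) * ∑⊆ T (λ U → sign U T * ∏ U y)     ≈⟨ *-congˡ (∑⊆sign∏≈∏-1 T y) ⟩
            fromℤ (χ T) * ∏ T (λ i → y i - 1#)               ∎

      Z-as-∑-nested : Z L R G χ y ≈ ∑ (λ T → when (nested T) (fromℤ (χ T) * ∏ T (λ i → y i - 1#)))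
      Z-as-∑-nested = begin
        Z L R G χ y
          ≈⟨ sumₗ-filter (nested? L G) (λ U → ℤ→R L R (χ° L G χ U) * prodR L R (map y (filter (_∈? U) (allFin n)))) (allSubsets n) ⟩
        sumₗ (map (λ U → when (nested U) (ℤ→R L R (χ° L G χ U) * prodR L R (map y (filter (_∈? U) (allFin n))))) (allSubsets n))
          ≈⟨ sumₗ-allSubsets (λ U → when (nested U) (ℤ→R L R (χ° L G χ U) * prodR L R (map y (filter (_∈? U) (allFin n))))) ⟩
        ∑ (λ U → when (nested U) (ℤ→R L R (χ° L G χ U) * prodR L R (map y (filter (_∈? U) (allFin n)))))
          ≈⟨ ∑-cong (λ U → when-cong (nested U) (*-cong (ℤ→R≈fromℤ (χ° L G χ U)) (productₗ-∈ U y))) ⟩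
        ∑ (λ U → when (nested U) (fromℤ (χ° L G χ U) * ∏ U y))
          ≈⟨ ∑-cong (λ U → by-U U (nested? L G U)) ⟩
        ∑ (λ U → ∑ (summand U))
          ≈⟨ ∑-swap summand ⟩
        ∑ (λ T → ∑ (λ U → summand U T))
          ≈⟨ ∑-cong by-T ⟩
        ∑ (λ T → when (nested T) (fromℤ (χ T) * ∏ T (λ i → y i - 1#))) ∎

module SubsetIdentities where

  open import Data.Fin.Subset.Properties using (x∈p∩q⁺; p∩q⊆p; ∪-identityʳ; p─⊥≡p)

  ─-∩ : ∀ {n} (F S : Subset n) → F ─ (S ∩ F) ≡ F ─ S
  ─-∩ []            []            = ≡.refl
  ─-∩ (inside ∷ F)  (inside ∷ S)  = ≡.cong (outside ∷_) (─-∩ F S)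
  ─-∩ (inside ∷ F)  (outside ∷ S) = ≡.cong (inside ∷_) (─-∩ F S)
  ─-∩ (outside ∷ F) (inside ∷ S)  = ≡.cong (outside ∷_) (─-∩ F S)
  ─-∩ (outside ∷ F) (outside ∷ S) = ≡.cong (outside ∷_) (─-∩ F S)

  ∪⁅⁆─⁅⁆ : ∀ {n} (b : Fin n) (S : Subset n) → b ∉ S → (S ∪ ⁅ b ⁆) ─ ⁅ b ⁆ ≡ S
  ∪⁅⁆─⁅⁆ zero    (inside ∷ S)  b∉S = ⊥-elim (b∉S here)
  ∪⁅⁆─⁅⁆ zero    (outside ∷ S) b∉S = ≡.cong (outside ∷_) (≡.trans (p─⊥≡p (S ∪ Sub.⊥)) (∪-identityʳ S))
  ∪⁅⁆─⁅⁆ (suc b) (inside ∷ S)  b∉S = ≡.cong (inside ∷_) (∪⁅⁆─⁅⁆ b S (λ b∈S → b∉S (there b∈S)))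
  ∪⁅⁆─⁅⁆ (suc b) (outside ∷ S) b∉S = ≡.cong (outside ∷_) (∪⁅⁆─⁅⁆ b S (λ b∈S → b∉S (there b∈S)))

  ─-∪⁅⁆ : ∀ {n} (b : Fin n) (F S : Subset n) → b ∉ F → F ─ (S ∪ ⁅ b ⁆) ≡ F ─ S
  ─-∪⁅⁆ zero    (inside ∷ F)  S       b∉F = ⊥-elim (b∉F here)
  ─-∪⁅⁆ zero    (outside ∷ F) (inside ∷ S)  b∉F = ≡.cong (λ X → outside ∷ (F ─ X)) (∪-identityʳ S)
  ─-∪⁅⁆ zero    (outside ∷ F) (outside ∷ S) b∉F = ≡.cong (λ X → outside ∷ (F ─ X)) (∪-identityʳ S)
  ─-∪⁅⁆ (suc b) (f ∷ F)       (inside ∷ S)  b∉F = ≡.cong (_ ∷_) (─-∪⁅⁆ b F S (λ b∈F → b∉F (there b∈F)))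
  ─-∪⁅⁆ (suc b) (f ∷ F)       (outside ∷ S) b∉F = ≡.cong (_ ∷_) (─-∪⁅⁆ b F S (λ b∈F → b∉F (there b∈F)))

  ∣p─p∣≡0 : ∀ {n} (p : Subset n) → ∣ p ─ p ∣ ≡ 0
  ∣p─p∣≡0 []            = ≡.refl
  ∣p─p∣≡0 (inside ∷ p)  = ∣p─p∣≡0 p
  ∣p─p∣≡0 (outside ∷ p) = ∣p─p∣≡0 p

  does-⊆-∩ : ∀ {n} (F S : Subset n) → does (F ⊆? (S ∩ F)) ≡ does (F ⊆? S)
  does-⊆-∩ F S with F ⊆? (S ∩ F) | F ⊆? S
  ... | yes _      | yes _   = ≡.refl
  ... | no F⊈S∩F  | yes F⊆S = ⊥-elim (F⊈S∩F (λ x∈F → x∈p∩q⁺ (F⊆S x∈F , x∈F)))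
  ... | yes F⊆S∩F | no F⊈S  = ⊥-elim (F⊈S (λ x∈F → p∩q⊆p S F (F⊆S∩F x∈F)))
  ... | no _       | no _    = ≡.refl

module BlowupSum {c ℓ : Level} {n : ℕ} (L : FinMeetSemilattice n) (R : CommutativeRing c ℓ)
    (G₁ : Subset n) (b : Fin n) (b∉G₁ : b ∉ G₁)
    (G₁-building : IsBuildingSet L G₁) (G₂-building : IsBuildingSet L (G₁ ∪ ⁅ b ⁆))
    (χ : Subset n → ℤ) (α αinv : Fin n → CommutativeRing.Carrier R)
    (α-inverse : ∀ g → g ∈ (G₁ ∪ ⁅ b ⁆) → CommutativeRing._≈_ R (CommutativeRing._*_ R (α g) (αinv g)) (CommutativeRing.1# R))
    (α-b : CommutativeRing._≈_ R (α b) (sumOverF L R G₁ b α)) where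

  open CommutativeRing R hiding (zero) renaming (Carrier to A)
  open IntegerCast R using (fromℤ; fromℤ-+; fromℤ-*; solve; _:+_; _:*_; :-_; _:=_; con)
  open SubsetSums R
  open SubsetIdentities
  open Order L using (nested-⊆)
  open Blowup L G₁ b b∉G₁ G₁-building G₂-building
    using (G₂; F; b∈G₂; G₁⊆G₂; F⊆G₁; b∉F; nested₁-b∉; nested₁⇒nested₂; nested₂⇔nested₁; nested₂-∪b⇔nested₁-∪F)
  open import Data.Fin.Subset.Properties using (p⊆p∪q)
  open import Function.Bundles using (Equivalence)
  open Relation.Binary.Reasoning.Setoid setoid

  z : Fin n → A
  z i = αinv i - 1#

  χ̂ : Subset n → A
  χ̂ T = fromℤ (χ T)

  -- The two summands are the weights Bl_b χ assigns to S ∪ F and, once z_b is absorbed, to S ∪ {b}.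
  coef : Subset n → A
  coef C = fromℤ (+ ∣ F ─ C ∣ ℤ.- + 1) + z b * fromℤ (+ ∣ F ─ C ∣)

  α-factor : ∀ i → i ∈ G₂ → α i * (1# + z i) ≈ 1#
  α-factor i i∈G₂ = trans (*-congˡ (solve 1 (λ a → con (+ 1) :+ (a :+ :- con (+ 1)) := a) refl (αinv i))) (α-inverse i i∈G₂)

  α-b≈∑∈F : α b ≈ ∑∈ F α
  α-b≈∑∈F = trans α-b (sumₗ-select (maxBelow? L G₁ b) α)

  ∑⊆coef∏≈0 : ∑⊆ F (λ C → coef C * ∏ C z) ≈ 0#
  ∑⊆coef∏≈0 = begin
    ∑⊆ F (λ C → coef C * ∏ C z)
      ≈⟨ ∑⊆-cong F (λ C → expand (fromℤ (+ ∣ F ─ C ∣)) (∏ C z) (fromℤ-+ (+ ∣ F ─ C ∣) (ℤ.- + 1))) ⟩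
    ∑⊆ F (λ C → (k C * ∏ C z + - ∏ C z) + z b * (k C * ∏ C z))
      ≈⟨ trans (∑⊆-+ F _ _) (+-cong (trans (∑⊆-+ F _ _) (+-congˡ (∑⊆-neg F (λ C → ∏ C z)))) (sym (∑⊆-*ˡ F (z b) _))) ⟩
    (W + - V) + z b * W
      ≈⟨ +-cong (+-cong W≈ (-‿cong (∑⊆∏≈∏1+ F z))) (*-congˡ W≈) ⟩
    (α b * P + - P) + z b * (α b * P)
      ≈⟨ solve 4 (λ a P w u → (a :* P :+ :- P) :+ w :* (a :* P) := (a :* (con (+ 1) :+ w)) :* P :+ :- P) refl (α b) P (z b) (αinv b) ⟩
    (α b * (1# + z b)) * P + - P
      ≈⟨ +-congʳ (trans (*-congʳ (α-factor b b∈G₂)) (*-identityˡ P)) ⟩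
    P + - P
      ≈⟨ -‿inverseʳ P ⟩
    0# ∎
    where
    k = λ C → fromℤ (+ ∣ F ─ C ∣)
    W = ∑⊆ F (λ C → k C * ∏ C z)
    V = ∑⊆ F (λ C → ∏ C z)
    P = ∏ F (λ i → 1# + z i)
    W≈ : W ≈ α b * P
    W≈ = trans (∑⊆∣─∣∏≈∑∈*∏1+ F z α (λ i i∈F → α-factor i (G₁⊆G₂ (F⊆G₁ i∈F)))) (*-congʳ (sym α-b≈∑∈F))
    expand : ∀ κ q {κ-1} → κ-1 ≈ κ + fromℤ (ℤ.- + 1) → (κ-1 + z b * κ) * q ≈ (κ * q + - q) + z b * (κ * q)
    expand κ q κ-1≈ = trans (*-congʳ (+-congʳ κ-1≈))
      (solve 3 (λ κ q w → (κ :+ :- con (+ 1) :+ w :* κ) :* q := (κ :* q :+ :- q) :+ w :* (κ :* q)) refl κ q (z b))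

  ∏F≈∑⊊coef∏ : ∏ F z ≈ ∑⊆ F (λ C → unless (does (F ⊆? C)) (coef C * ∏ C z))
  ∏F≈∑⊊coef∏ = sym (begin
    proper                                           ≈⟨ solve 2 (λ s x → s := (s :+ x) :+ :- x) refl proper (coef F * ∏ F z) ⟩
    (proper + coef F * ∏ F z) + - (coef F * ∏ F z)  ≈⟨ +-congʳ (∑⊆≈∑⊊+whole F (λ C → coef C * ∏ C z)) ⟨
    ∑⊆ F (λ C → coef C * ∏ C z) + - (coef F * ∏ F z) ≈⟨ +-cong ∑⊆coef∏≈0 (-‿cong (*-congʳ coef-F)) ⟩
    0# + - ((- 1# + z b * 0#) * ∏ F z)               ≈⟨ solve 2 (λ w q → con (+ 0) :+ :- ((:- con (+ 1) :+ w :* con (+ 0)) :* q) := q)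
                                                           refl (z b) (∏ F z) ⟩
    ∏ F z                                            ∎)
    where
    proper = ∑⊆ F (λ C → unless (does (F ⊆? C)) (coef C * ∏ C z))
    coef-F : coef F ≈ - 1# + z b * 0#
    coef-F = reflexive (≡.cong (λ k → fromℤ (+ k ℤ.- + 1) + z b * fromℤ (+ k)) (∣p─p∣≡0 F))

  nested₁? : ∀ S → Dec (IsNested L G₁ S)
  nested₁? = nested? L G₁

  nested₂? : ∀ S → Dec (IsNested L G₂ S)
  nested₂? = nested? L G₂

  lhs : Subset n → A
  lhs T = when (does (nested₁? T)) (χ̂ T * ∏ T z)

  rhs : Subset n → A
  rhs S = when (does (nested₂? S)) (fromℤ (Bl L G₁ b χ S) * ∏ S z)

  rhs-kept rhs-merged rhs-blown : Subset n → A
  rhs-kept S   = unless (does (b ∈? S)) (when (does (nested₂? S)) (χ̂ S * ∏ S z))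
  rhs-merged S = unless (does (b ∈? S)) (when (does (nested₂? S)) (when (does (nested₁? (S ∪ F)))
                   (χ̂ (S ∪ F) * fromℤ (+ ∣ F ─ S ∣ ℤ.- + 1) * ∏ S z)))
  rhs-blown S  = when (does (b ∈? S)) (when (does (nested₂? S)) (χ̂ ((S ─ ⁅ b ⁆) ∪ F) * fromℤ (+ ∣ F ─ S ∣) * ∏ S z))

  private
    0≈0+0 : 0# ≈ 0# + 0#
    0≈0+0 = sym (+-identityʳ 0#)

  rhs-split : ∀ S → rhs S ≈ rhs-kept S + (rhs-merged S + rhs-blown S)
  rhs-split S = split (nested₂? S) (nested₁? (S ∪ F))
    where
    split : (d₂ : Dec (IsNested L G₂ S)) (d₁ : Dec (IsNested L G₁ (S ∪ F))) →
      when (does d₂) (fromℤ (Bl L G₁ b χ S) * ∏ S z)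
      ≈ unless (does (b ∈? S)) (when (does d₂) (χ̂ S * ∏ S z))
        + (unless (does (b ∈? S)) (when (does d₂) (when (does d₁) (χ̂ (S ∪ F) * fromℤ (+ ∣ F ─ S ∣ ℤ.- + 1) * ∏ S z)))
           + when (does (b ∈? S)) (when (does d₂) (χ̂ ((S ─ ⁅ b ⁆) ∪ F) * fromℤ (+ ∣ F ─ S ∣) * ∏ S z)))
    split d₂ d₁ with b ∈? S | nested? L G₁ (S ∪ F)
    split (yes _) _       | yes _ | _ =
      trans (*-congʳ (fromℤ-* (χ ((S ─ ⁅ b ⁆) ∪ F)) (+ ∣ F ─ S ∣))) (sym (trans (+-identityˡ _) (+-identityˡ _)))
    split (no _)  _       | yes _ | _     = trans 0≈0+0 (+-congˡ 0≈0+0)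
    split (yes _) (yes _) | no _  | yes _ =
      trans (*-congʳ (trans (fromℤ-+ (χ S) (χ (S ∪ F) ℤ.* (+ ∣ F ─ S ∣ ℤ.- + 1)))
                            (+-congˡ (fromℤ-* (χ (S ∪ F)) (+ ∣ F ─ S ∣ ℤ.- + 1)))))
            (trans (distribʳ _ _ _) (+-congˡ (sym (+-identityʳ _))))
    split (yes _) (no ¬n) | no _  | yes n = ⊥-elim (¬n n)
    split (yes _) (yes n) | no _  | no ¬n = ⊥-elim (¬n n)
    split (yes _) (no _)  | no _  | no _  = sym (trans (+-congˡ (+-identityʳ 0#)) (+-identityʳ _))
    split (no _)  _       | no _  | _     = trans 0≈0+0 (+-congˡ 0≈0+0)

  lhs-avoiding-F : ∀ S → unless (does (F ⊆? S)) (lhs S) ≈ rhs-kept S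
  lhs-avoiding-F S = agree (nested₁? S) (nested₂? S) (F ⊆? S) (b ∈? S)
    where
    agree : ∀ {X} (d₁ : Dec (IsNested L G₁ S)) (d₂ : Dec (IsNested L G₂ S)) (dF : Dec (F ⊆ S)) (db : Dec (b ∈ S)) →
            unless (does dF) (when (does d₁) X) ≈ unless (does db) (when (does d₂) X)
    agree (yes S-nested₁) _ _ (yes b∈S)  = ⊥-elim (nested₁-b∉ S-nested₁ b∈S)
    agree (no _)          _ dF (yes _)   = unless-0 (does dF)
    agree _ (yes S-nested₂) (yes F⊆S) (no b∉S) = ⊥-elim (proj₂ (Equivalence.to (nested₂⇔nested₁ b∉S) S-nested₂) F⊆S)
    agree _ (no _)          (yes _)   (no _)   = refl
    agree (yes _) (yes _) (no _) (no _) = refl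
    agree (yes S-nested₁) (no S-not-nested₂) (no F⊈S) (no b∉S) =
      ⊥-elim (S-not-nested₂ (Equivalence.from (nested₂⇔nested₁ b∉S) (S-nested₁ , F⊈S)))
    agree (no S-not-nested₁) (yes S-nested₂) (no _) (no b∉S) =
      ⊥-elim (S-not-nested₁ (proj₁ (Equivalence.to (nested₂⇔nested₁ b∉S) S-nested₂)))
    agree (no _) (no _) (no _) (no _) = refl

  -- the coefficient of ∏_{T ∖ F} z · ∏_C z in lhs T once ∏_F z is expanded
  H : Subset n → Subset n → A
  H T C = when (does (nested₁? T)) (unless (does (F ⊆? C)) (χ̂ T * coef C))

  lhs-⊇F-expand : ∀ T → when (does (F ⊆? T)) (lhs T) ≈ when (does (F ⊆? T)) (∑⊆ F (λ C → H T C * (∏ (T ─ F) z * ∏ C z)))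
  lhs-⊇F-expand T = expand (F ⊆? T) (nested₁? T)
    where
    rearrange : ∀ β β′ a p k q → a * (p * when β (unless β′ (k * q))) ≈ when β (unless β′ (a * k) * (p * q))
    rearrange true  false a p k q = solve 4 (λ a p k q → a :* (p :* (k :* q)) := (a :* k) :* (p :* q)) refl a p k q
    rearrange true  true  a p k q = trans (*-congˡ (zeroʳ p)) (trans (zeroʳ a) (sym (zeroˡ _)))
    rearrange false β′    a p k q = trans (*-congˡ (zeroʳ p)) (zeroʳ a)

    expand : (dF : Dec (F ⊆ T)) (d₁ : Dec (IsNested L G₁ T)) →
      when (does dF) (when (does d₁) (χ̂ T * ∏ T z))
      ≈ when (does dF) (∑⊆ F (λ C → when (does d₁) (unless (does (F ⊆? C)) (χ̂ T * coef C)) * (∏ (T ─ F) z * ∏ C z)))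
    expand (no _)    _       = refl
    expand (yes _)   (no _)  = sym (trans (∑⊆-cong F (λ C → zeroˡ _)) (trans (∑-cong (λ C → when-0 (does (C ⊆? F)))) (∑-0 {n})))
    expand (yes F⊆T) (yes _) = begin
      χ̂ T * ∏ T z                                                ≈⟨ *-congˡ (∏-─-split F T F⊆T z) ⟩
      χ̂ T * (∏ (T ─ F) z * ∏ F z)                                ≈⟨ *-congˡ (*-congˡ ∏F≈∑⊊coef∏) ⟩
      χ̂ T * (∏ (T ─ F) z * ∑ proper)                             ≈⟨ *-congˡ (∑-*ˡ (∏ (T ─ F) z) proper) ⟩
      χ̂ T * ∑ (λ C → ∏ (T ─ F) z * proper C)                     ≈⟨ ∑-*ˡ (χ̂ T) (λ C → ∏ (T ─ F) z * proper C) ⟩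
      ∑ (λ C → χ̂ T * (∏ (T ─ F) z * proper C))                   ≈⟨ ∑-cong (λ C → rearrange (does (C ⊆? F)) (does (F ⊆? C))
                                                                       (χ̂ T) (∏ (T ─ F) z) (coef C) (∏ C z)) ⟩
      ∑⊆ F (λ C → unless (does (F ⊆? C)) (χ̂ T * coef C) * (∏ (T ─ F) z * ∏ C z)) ∎
      where
      proper : Subset n → A
      proper C = when (does (C ⊆? F)) (unless (does (F ⊆? C)) (coef C * ∏ C z))

  rhs-blown′ : Subset n → A
  rhs-blown′ S = when (does (nested₁? (S ∪ F))) (unless (does (F ⊆? S)) (χ̂ (S ∪ F) * (z b * fromℤ (+ ∣ F ─ S ∣)) * ∏ S z))

  H-split : ∀ S → H (S ∪ F) (S ∩ F) * ∏ S z ≈ rhs-merged S + rhs-blown′ S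
  H-split S = trans (*-congʳ (reflexive H-∩)) (split (nested₁? (S ∪ F)) (F ⊆? S) (nested₂? S) (b ∈? S))
    where
    H-∩ : H (S ∪ F) (S ∩ F) ≡ when (does (nested₁? (S ∪ F))) (unless (does (F ⊆? S)) (χ̂ (S ∪ F) * coef S))
    H-∩ = ≡.cong₂ (λ β κ → when (does (nested₁? (S ∪ F))) (unless β (χ̂ (S ∪ F) * κ))) (does-⊆-∩ F S)
            (≡.cong (λ X → fromℤ (+ ∣ X ∣ ℤ.- + 1) + z b * fromℤ (+ ∣ X ∣)) (─-∩ F S))
    split : (d₁ : Dec (IsNested L G₁ (S ∪ F))) (dF : Dec (F ⊆ S)) (d₂ : Dec (IsNested L G₂ S)) (db : Dec (b ∈ S)) →
      when (does d₁) (unless (does dF) (χ̂ (S ∪ F) * coef S)) * ∏ S z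
      ≈ unless (does db) (when (does d₂) (when (does d₁) (χ̂ (S ∪ F) * fromℤ (+ ∣ F ─ S ∣ ℤ.- + 1) * ∏ S z)))
        + when (does d₁) (unless (does dF) (χ̂ (S ∪ F) * (z b * fromℤ (+ ∣ F ─ S ∣)) * ∏ S z))
    split (no _) _ d₂ db = trans (zeroˡ _) (sym (trans (+-identityʳ _) (unless-0′ (does db) (does d₂))))
      where
      unless-0′ : ∀ β γ → unless β (when γ 0#) ≈ 0#
      unless-0′ true  γ = refl
      unless-0′ false γ = when-0 γ
    split (yes S∪F-nested₁) _ _ (yes b∈S) = ⊥-elim (nested₁-b∉ S∪F-nested₁ (x∈p∪q⁺ (inj₁ b∈S)))
    split (yes _) (yes F⊆S) (yes S-nested₂) (no b∉S) = ⊥-elim (proj₂ (Equivalence.to (nested₂⇔nested₁ b∉S) S-nested₂) F⊆S)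
    split (yes _) (yes _)   (no _)          (no _)   = trans (zeroˡ _) 0≈0+0
    split (yes S∪F-nested₁) (no F⊈S) (no S-not-nested₂) (no _) =
      ⊥-elim (S-not-nested₂ (nested₁⇒nested₂ (nested-⊆ S∪F-nested₁ (p⊆p∪q F)) F⊈S))
    split (yes _) (no _) (yes _) (no _) =
      solve 5 (λ a x w y q → (a :* (x :+ w :* y)) :* q := a :* x :* q :+ a :* (w :* y) :* q) refl
        (χ̂ (S ∪ F)) (fromℤ (+ ∣ F ─ S ∣ ℤ.- + 1)) (z b) (fromℤ (+ ∣ F ─ S ∣)) (∏ S z)

  ∑rhs-blown≈∑rhs-blown′ : ∑ rhs-blown ≈ ∑ rhs-blown′
  ∑rhs-blown≈∑rhs-blown′ =
    trans (∑-∋-shift b (λ S → when (does (nested₂? S)) (χ̂ ((S ─ ⁅ b ⁆) ∪ F) * fromℤ (+ ∣ F ─ S ∣) * ∏ S z)))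
    (∑-cong (λ S → shifted S (b ∈? S) (nested₂? (S ∪ ⁅ b ⁆)) (nested₁? (S ∪ F)) (F ⊆? S)))
    where
    shifted : ∀ S (db : Dec (b ∈ S)) (d₂ : Dec (IsNested L G₂ (S ∪ ⁅ b ⁆)))
                  (d₁ : Dec (IsNested L G₁ (S ∪ F))) (dF : Dec (F ⊆ S)) →
      unless (does db) (when (does d₂) (χ̂ (((S ∪ ⁅ b ⁆) ─ ⁅ b ⁆) ∪ F) * fromℤ (+ ∣ F ─ (S ∪ ⁅ b ⁆) ∣) * ∏ (S ∪ ⁅ b ⁆) z))
      ≈ when (does d₁) (unless (does dF) (χ̂ (S ∪ F) * (z b * fromℤ (+ ∣ F ─ S ∣)) * ∏ S z))
    shifted S (yes b∈S) _ (yes S∪F-nested₁) _ = ⊥-elim (nested₁-b∉ S∪F-nested₁ (x∈p∪q⁺ (inj₁ b∈S)))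
    shifted S (yes _)   _ (no _)            _ = refl
    shifted S (no b∉S) (yes S∪b-nested₂) d₁ dF rewrite ∪⁅⁆─⁅⁆ b S b∉S | ─-∪⁅⁆ b F S b∉F = nonzero d₁ dF
      where
      nonzero : (d₁ : Dec (IsNested L G₁ (S ∪ F))) (dF : Dec (F ⊆ S)) →
        χ̂ (S ∪ F) * fromℤ (+ ∣ F ─ S ∣) * ∏ (S ∪ ⁅ b ⁆) z
        ≈ when (does d₁) (unless (does dF) (χ̂ (S ∪ F) * (z b * fromℤ (+ ∣ F ─ S ∣)) * ∏ S z))
      nonzero (no S∪F-not-nested₁) _ =
        ⊥-elim (S∪F-not-nested₁ (proj₁ (Equivalence.to (nested₂-∪b⇔nested₁-∪F b∉S) S∪b-nested₂)))
      nonzero (yes _) (yes F⊆S) = ⊥-elim (proj₂ (Equivalence.to (nested₂-∪b⇔nested₁-∪F b∉S) S∪b-nested₂) F⊆S)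
      nonzero (yes _) (no _) = trans (*-congˡ (∏-∪⁅⁆ b S b∉S z))
        (solve 4 (λ a k w q → a :* k :* (w :* q) := a :* (w :* k) :* q) refl (χ̂ (S ∪ F)) (fromℤ (+ ∣ F ─ S ∣)) (z b) (∏ S z))
    shifted S (no b∉S) (no S∪b-not-nested₂) (yes S∪F-nested₁) (no F⊈S) =
      ⊥-elim (S∪b-not-nested₂ (Equivalence.from (nested₂-∪b⇔nested₁-∪F b∉S) (S∪F-nested₁ , F⊈S)))
    shifted S (no _) (no _) (yes _) (yes _) = refl
    shifted S (no _) (no _) (no _)  _       = refl

  ∑lhs-⊇F : ∑ (λ T → when (does (F ⊆? T)) (lhs T)) ≈ ∑ rhs-merged + ∑ rhs-blown
  ∑lhs-⊇F = begin
    ∑ (λ T → when (does (F ⊆? T)) (lhs T))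
      ≈⟨ ∑-cong lhs-⊇F-expand ⟩
    ∑ (λ T → when (does (F ⊆? T)) (∑⊆ F (λ C → H T C * (∏ (T ─ F) z * ∏ C z))))
      ≈⟨ ∑⊇∑⊆-reindex F (λ T C → H T C * (∏ (T ─ F) z * ∏ C z)) ⟩
    ∑ (λ S → H (S ∪ F) (S ∩ F) * (∏ ((S ∪ F) ─ F) z * ∏ (S ∩ F) z))
      ≈⟨ ∑-cong (λ S → *-congˡ (∏-∪-─-∩ S F z)) ⟩
    ∑ (λ S → H (S ∪ F) (S ∩ F) * ∏ S z)
      ≈⟨ trans (∑-cong H-split) (∑-+ rhs-merged rhs-blown′) ⟩
    ∑ rhs-merged + ∑ rhs-blown′
      ≈⟨ +-congˡ ∑rhs-blown≈∑rhs-blown′ ⟨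
    ∑ rhs-merged + ∑ rhs-blown ∎

theorem2 : ∀ {c ℓ : Level} {n : ℕ} (L : FinMeetSemilattice n) (R : CommutativeRing c ℓ)
    (G₁ : Subset n) (b : Fin n) → b ∉ G₁ →
    IsBuildingSet L G₁ → IsBuildingSet L (G₁ ∪ ⁅ b ⁆) →
    (χ : Subset n → ℤ) (α αinv : Fin n → CommutativeRing.Carrier R) →
    (∀ g → g ∈ (G₁ ∪ ⁅ b ⁆) → CommutativeRing._≈_ R (CommutativeRing._*_ R (α g) (αinv g)) (CommutativeRing.1# R)) →
    CommutativeRing._≈_ R (α b) (sumOverF L R G₁ b α) →
    CommutativeRing._≈_ R (Z L R G₁ χ αinv) (Z L R (G₁ ∪ ⁅ b ⁆) (Bl L G₁ b χ) αinv)
theorem2 L R G₁ b b∉G₁ G₁-building G₂-building χ α αinv α-inverse α-b = begin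
  Z L R G₁ χ αinv
    ≈⟨ Z-as-∑-nested G₁ χ αinv ⟩
  ∑ lhs
    ≈⟨ ∑-cong (λ T → unless+when (does (F ⊆? T)) (lhs T)) ⟩
  ∑ (λ T → unless (does (F ⊆? T)) (lhs T) + when (does (F ⊆? T)) (lhs T))
    ≈⟨ ∑-+ (λ T → unless (does (F ⊆? T)) (lhs T)) (λ T → when (does (F ⊆? T)) (lhs T)) ⟩
  ∑ (λ T → unless (does (F ⊆? T)) (lhs T)) + ∑ (λ T → when (does (F ⊆? T)) (lhs T))
    ≈⟨ +-cong (∑-cong lhs-avoiding-F) ∑lhs-⊇F ⟩
  ∑ rhs-kept + (∑ rhs-merged + ∑ rhs-blown)
    ≈⟨ trans (∑-+ rhs-kept (λ S → rhs-merged S + rhs-blown S)) (+-congˡ (∑-+ rhs-merged rhs-blown)) ⟨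
  ∑ (λ S → rhs-kept S + (rhs-merged S + rhs-blown S))
    ≈⟨ ∑-cong rhs-split ⟨
  ∑ rhs
    ≈⟨ Z-as-∑-nested (G₁ ∪ ⁅ b ⁆) (Bl L G₁ b χ) αinv ⟨
  Z L R (G₁ ∪ ⁅ b ⁆) (Bl L G₁ b χ) αinv ∎
  where
  open CommutativeRing R
  open Relation.Binary.Reasoning.Setoid setoid
  open SubsetSums R using (∑; ∑-cong; ∑-+; when; unless; unless+when)
  open NestedSum L R using (Z-as-∑-nested)
  open Blowup L G₁ b b∉G₁ G₁-building G₂-building using (F)
  open BlowupSum L R G₁ b b∉G₁ G₁-building G₂-building χ α αinv α-inverse α-b
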